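{- Let $F\subseteq[n]$ with $\#F=k\ge1$. Then $P_F$ is a unimodular simplicial complex isomorphic to the braid triangulation $C^{n-k+1}$ of the $(n-k+1)$-dimensional unit cube. Moreover, for all $0\le i\le n-k+1$, \[ f_i(P_F)=\sum_{j=0}^{i}(-1)^j\binom{i}{j}(i-j+2)^{n-k+1}. \] Finally, if $n'\ge n-k+1$ and $0\le i\le n'+1$, then \[ h^{n'}_i(P_F)=(-1)^i\binom{n'+1}{i}+\sum_{a=0}^{i-1}\sum_{b=0}^{a}(-1)^{i-a+b-1}\binom{n'-a}{i-a-1}\binom{a}{b}(a-b+2)^{n-k+1}. \]
   Context: Identify each subset $A\subseteq[n]$ with its $0/1$ indicator vector in $\mathbb{R}^n$. The braid triangulation $C^n$ of $[0,1]^n$ is the triangulation induced by the hyperplanes $\{x_i=x_j\}$: its simplices are the convex hulls of the chains $A_1\subsetneq\cdots\subsetneq A_l$ ($l\ge1$) of subsets of $[n]$. For $F\subseteq[n]$ let $H_F=\{x\in\mathbb{R}^n: x_v=x_w \text{ for all } v,w\in F\}$ and let $P_F$ be the subcomplex of $C^n$ consisting of the simplices contained in $H_F\cap[0,1]^n$. A simplicial complex is unimodular if each of its simplices is lattice equivalent (via a map in $GL(n,\mathbb{Z})$) to a simplex whose vertices are among the standard unit vectors and the origin. $f_i(P_F)$ denotes the number of $i$-dimensional simplices of $P_F$ (equivalently the $i$-th entry of the $f$-vector of the Ehrhart polynomial $L_{P_F}(k)=\#(kP_F\cap\mathbb{Z}^n)$, defined by $L_{P_F}(k)=\sum_i f_i\binom{k-1}{i}$),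 with $f_{ -1}(P_F)=1$ and $f_j(P_F)=0$ for $j>n-k+1$. For $n'\ge n-k+1$, the $h$-vector with parameter $n'$ is $h^{n'}_i(P_F)=\sum_{j=-1}^{i-1}(-1)^{i-j-1}\binom{n'-j}{i-j-1}f_j(P_F)$ for $0\le i\le n'+1$ (equivalently, defined by $L_{P_F}(k)=\binom{k+n'}{n'}+\sum_{i=1}^{n'+1}h^{n'}_i\binom{k+n'-i}{n'}$, $h_0^{n'}=1$). -}

module Defs where

open import Data.Nat as ℕ using (ℕ; zero; suc)
open import Data.Integer as ℤ using (ℤ; +_; -_)
open import Data.Bool using (Bool; true; false; if_then_else_)
open import Data.Fin using (Fin; zero; suc)
open import Data.Fin.Properties using (all?; any?)
open import Data.Fin.Subset using (Subset; _∈_; _∉_; _⊆_; _⊂_; inside; outside)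
open import Data.Fin.Subset.Properties using (_∈?_; _⊆?_)
open import Data.Vec using (Vec; []; _∷_; lookup)
open import Data.List using (List; []; _∷_; map; _++_; concatMap; filter; length)
open import Data.List.Relation.Unary.Linked using (Linked; linked?)
open import Data.List.Relation.Unary.All using (All) renaming (all? to allL?)
open import Data.List.Relation.Unary.AllPairs using (AllPairs)
open import Data.List.Relation.Unary.Unique.Propositional using (Unique)
open import Data.Product using (_×_; _,_; ∃; ∃₂)
open import Data.Sum using (_⊎_)
open import Relation.Nullary using (Dec; ¬_)
open import Relation.Nullary.Decidable using (_×-dec_; _→-dec_; ¬?)
open import Relation.Binary.PropositionalEquality using (_≡_; _≢_)
open import Data.Fin using (_≟_)
open import Data.Nat.Combinatorics using (_C_)

-- Vertices: subsets A ⊆ [n] (as Subset n), identified with 0/1 vectors.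

indicator : ∀ {n} → Subset n → Fin n → ℤ
indicator A v = if lookup A v then + 1 else + 0

InH : ∀ {n} → Subset n → Subset n → Set
InH F A = ∀ v w → v ∈ F → w ∈ F → lookup A v ≡ lookup A w

InH? : ∀ {n} (F A : Subset n) → Dec (InH F A)
InH? F A = all? λ v → all? λ w →
  (v ∈? F) →-dec ((w ∈? F) →-dec (lookup A v Data.Bool.≟ lookup A w))
  where import Data.Bool

-- Simplices of the braid triangulation C^n: (vertex sets of) chains
-- A_1 ⊊ ⋯ ⊊ A_l, l ≥ 1.  As a *set* of vertices, a simplex is a
-- nonempty finite set of pairwise ⊆-comparable distinct subsets;
-- we represent it by a list without repetitions.

Comparable : ∀ {n} → Subset n → Subset n → Set
Comparable A B = A ⊆ B ⊎ B ⊆ A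

IsChain : ∀ {n} → List (Subset n) → Set
IsChain []       = Data.Empty.⊥  where import Data.Empty
IsChain (A ∷ As) = Unique (A ∷ As) × AllPairs Comparable (A ∷ As)

-- Simplices of P_F: simplices of C^n contained in H_F ∩ [0,1]^n.
-- (Since H_F is a linear subspace, the convex hull of the vertices lies
-- in H_F iff every vertex does.)
IsSimplexP : ∀ {n} → Subset n → List (Subset n) → Set
IsSimplexP F L = IsChain L × All (InH F) L

-- Counting simplices: f_i(P_F) = number of i-dimensional simplices of P_F
-- = number of strictly increasing sequences A_0 ⊊ ⋯ ⊊ A_i of vertices of P_F
-- (each simplex has exactly one such increasing ordering).

allSubsets : (n : ℕ) → List (Subset n)
allSubsets zero    = [] ∷ []
allSubsets (suc n) = map (inside ∷_) (allSubsets n) ++ map (outside ∷_) (allSubsets n)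

listsOfLength : (n l : ℕ) → List (List (Subset n))
listsOfLength n zero    = [] ∷ []
listsOfLength n (suc l) =
  concatMap (λ A → map (A ∷_) (listsOfLength n l)) (allSubsets n)

_⊂?_ : ∀ {n} (A B : Subset n) → Dec (A ⊂ B)
A ⊂? B = (A ⊆? B) ×-dec any? (λ x → (x ∈? B) ×-dec ¬? (x ∈? A))

StrictChainIn : ∀ {n} → Subset n → List (Subset n) → Set
StrictChainIn F L = Linked _⊂_ L × All (InH F) L

StrictChainIn? : ∀ {n} (F : Subset n) (L : List (Subset n)) → Dec (StrictChainIn F L)
StrictChainIn? F L = linked? _⊂?_ L ×-dec allL? (InH? F) L

fP : ∀ {n} → Subset n → ℕ → ℕ
fP {n} F i = length (filter (StrictChainIn? F) (listsOfLength n (suc i)))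

-- Shifted f-vector: fP₋ F j = f_{j-1}(P_F), so fP₋ F 0 = f_{-1} = 1.
fP₋ : ∀ {n} → Subset n → ℕ → ℕ
fP₋ F zero    = 1
fP₋ F (suc j) = fP F j

Σ≤ : ℕ → (ℕ → ℤ) → ℤ
Σ≤ zero    g = g 0
Σ≤ (suc m) g = Σ≤ m g ℤ.+ g (suc m)

Σ< : ℕ → (ℕ → ℤ) → ℤ
Σ< zero    g = + 0
Σ< (suc m) g = Σ< m g ℤ.+ g m

sgn : ℕ → ℤ
sgn zero    = + 1
sgn (suc e) = - sgn e

-- h-vector with parameter n':
-- h^{n'}_i = Σ_{j=-1}^{i-1} (-1)^{i-j-1} C(n'-j, i-j-1) f_j.
-- Substituting j = j' - 1 with j' = 0..i:
-- h^{n'}_i = Σ_{j'=0}^{i} (-1)^{i-j'} C(n'+1-j', i-j') f_{j'-1}.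
hP : ∀ {n} → Subset n → (n' i : ℕ) → ℤ
hP F n' i = Σ≤ i λ j' →
  sgn (i ℕ.∸ j') ℤ.* + ((suc n' ℕ.∸ j') C (i ℕ.∸ j')) ℤ.* + fP₋ F j'

ΣFin : ∀ {n} → (Fin n → ℤ) → ℤ
ΣFin {zero}  g = + 0
ΣFin {suc n} g = g zero ℤ.+ ΣFin (λ i → g (suc i))

Matrix : ℕ → Set
Matrix n = Fin n → Fin n → ℤ

_·ᴹ_ : ∀ {n} → Matrix n → Matrix n → Matrix n
(M ·ᴹ N) i j = ΣFin λ k → M i k ℤ.* N k j

_·ᵛ_ : ∀ {n} → Matrix n → (Fin n → ℤ) → (Fin n → ℤ)
(M ·ᵛ x) i = ΣFin λ k → M i k ℤ.* x k

idM : ∀ {n} → Matrix n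
idM i j with i ≟ j
... | Relation.Nullary.yes _ = + 1
... | Relation.Nullary.no  _ = + 0

unitVec : ∀ {n} → Fin n → Fin n → ℤ
unitVec j = idM j

IsStdVertex : ∀ {n} → (Fin n → ℤ) → Set
IsStdVertex {n} x = (∀ i → x i ≡ + 0) ⊎ ∃ λ (j : Fin n) → ∀ i → x i ≡ unitVec j i

IsGLℤ : ∀ {n} → Matrix n → Set
IsGLℤ {n} M = ∃ λ (N : Matrix n) → (∀ i j → (M ·ᴹ N) i j ≡ idM i j) × (∀ i j → (N ·ᴹ M) i j ≡ idM i j)

UnimodularSimplex : ∀ {n} → List (Subset n) → Set
UnimodularSimplex {n} L = ∃ λ (M : Matrix n) → IsGLℤ M × All (λ A → IsStdVertex (M ·ᵛ indicator A)) L

UnimodularP : ∀ {n} → Subset n → Set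
UnimodularP F = ∀ L → IsSimplexP F L → UnimodularSimplex L

IsoToBraid : ∀ {n} → Subset n → (m : ℕ) → Set
IsoToBraid {n} F m =
  ∃₂ λ (φ : Subset n → Subset m) (ψ : Subset m → Subset n) →
    (∀ B → InH F (ψ B)) ×
    (∀ B → φ (ψ B) ≡ B) ×
    (∀ A → InH F A → ψ (φ A) ≡ A) ×
    (∀ L → All (InH F) L → (IsChain L → IsChain (map φ L)) × (IsChain (map φ L) → IsChain L))

module Submission where

-- Write m = |∁F| + 1 = n - k + 1.  The vertices of P_F are the subsets A
-- constant on F; they correspond bijectively to the subsets of [m] via
-- ψ (c ∷ B) = "c on F, B on ∁F", and ψ is an order embedding.  Hence ψ
-- identifies the simplices (chains) of C^m and P_F, and so f(P_F) = f(C^m).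
-- Counting chains A₀ ⊊ ⋯ ⊊ A_i in C^m by the recursion "choose the next set
-- among the strict supersets" gives f_i = Σ_s C(m,s) G i s, which binomial
-- identities turn into Σ_j (-1)^j C(i,j) (i-j+2)^m; the h-vector is a fixed
-- linear combination of the f-vector.  Unimodularity: every chain of C^n
-- consists of initial segments of one ordering of [n], so a permutation
-- followed by the difference matrix maps its vertices to 0 and unit vectors.

open import Defs
open import Data.Nat as ℕ using (ℕ; suc; _≤_; _∸_)
open import Data.Integer as ℤ using (ℤ; +_)
open import Data.Fin.Subset using (Subset; ∣_∣)
open import Data.Nat.Combinatorics using (_C_)
open import Data.Product using (_×_)
open import Relation.Binary.PropositionalEquality using (_≡_)

open import Data.Nat using (zero; _<_; z≤n; s≤s)
import Data.Nat.Properties as ℕP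
open import Data.Nat.Combinatorics using (nCn≡1; nCk+nC[k+1]≡[n+1]C[k+1]; k>n⇒nCk≡0)
import Data.Integer.Properties as ℤP
open import Data.Integer.Tactic.RingSolver using (solve-∀)
open import Data.Bool using (Bool; true; false; if_then_else_)
import Data.Bool as Bool
import Data.Bool.Properties as BoolP
open import Data.Fin using (Fin; zero; suc; toℕ; fromℕ<; punchIn; punchOut)
import Data.Fin as Fin
import Data.Fin.Properties as FinP
open import Data.Fin.Properties using (all?; any?)
open import Data.Fin.Subset using (_⊆_; _⊂_; _∈_; Nonempty; ∁; ⊥; inside; outside)
open import Data.Fin.Subset.Properties
  using (_⊆?_; _∈?_; ⊆-antisym; ⊆-reflexive; drop-∷-⊆; in⊆in; out⊆; ∉⊥; ⊥⊆; ∣p∣≤n; p⊆q⇒∣p∣≤∣q∣; ∣∁p∣≡n∸∣p∣)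
open import Data.Fin.Permutation as Perm using (Permutation; _⟨$⟩ʳ_; _⟨$⟩ˡ_; insert; insert-punchIn)
open import Data.Vec using ([]; _∷_; lookup; here; there)
import Data.Vec.Properties as VecP
open import Data.List using (List; []; _∷_; map; _++_; concatMap; filter; length)
import Data.List.Properties as ListP
open import Data.List.Membership.Propositional using () renaming (_∈_ to _∈ₗ_)
import Data.List.Membership.Propositional.Properties as MemP
open import Data.List.Relation.Unary.Any using (here; there)
open import Data.List.Relation.Unary.All as All using (All) renaming ([] to []ᵃ; _∷_ to _∷ᵃ_)
open import Data.List.Relation.Unary.AllPairs as AllPairs using (AllPairs; _∷_)
import Data.List.Relation.Unary.AllPairs.Properties as AllPairsP
open import Data.List.Relation.Unary.Linked using ([-]; _∷_)
open import Data.Product using (Σ; _,_; proj₁; proj₂)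
open import Data.Sum as Sum using (_⊎_; inj₁; inj₂; [_,_]′)
open import Algebra.Properties.Semiring.Sum ℤP.+-*-semiring
  using (sum; ∑-comm; *-distribˡ-sum; *-distribʳ-sum; sum-replicate-zero)
open import Algebra.Properties.CommutativeSemigroup ℤP.+-commutativeSemigroup
  using () renaming (interchange to +-interchange)
open import Algebra.Properties.CommutativeSemigroup ℤP.*-commutativeSemigroup
  using () renaming (x∙yz≈y∙xz to *-left-comm)
open import Function using (_∘_; _⇔_; mk⇔; Equivalence)
open import Relation.Nullary using (Dec; yes; no; does; ¬_; ¬?; _×-dec_; _→-dec_; contradiction)
open import Relation.Binary.Definitions using (DecidableEquality)
open import Relation.Binary.PropositionalEquality
  using (_≢_; refl; sym; trans; cong; cong₂; subst; module ≡-Reasoning)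

Σ<-cong : ∀ m {f g : ℕ → ℤ} → (∀ j → j < m → f j ≡ g j) → Σ< m f ≡ Σ< m g
Σ<-cong zero    f≡g = refl
Σ<-cong (suc m) f≡g =
  cong₂ ℤ._+_ (Σ<-cong m λ j j<m → f≡g j (ℕP.m<n⇒m<1+n j<m)) (f≡g m ℕP.≤-refl)

Σ<-front : ∀ m (f : ℕ → ℤ) → Σ< (suc m) f ≡ f 0 ℤ.+ Σ< m (f ∘ suc)
Σ<-front zero    f = trans (ℤP.+-identityˡ (f 0)) (sym (ℤP.+-identityʳ (f 0)))
Σ<-front (suc m) f = trans (cong (ℤ._+ f (suc m)) (Σ<-front m f)) (ℤP.+-assoc (f 0) _ _)

Σ<-+ : ∀ m (f g : ℕ → ℤ) → Σ< m (λ j → f j ℤ.+ g j) ≡ Σ< m f ℤ.+ Σ< m g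
Σ<-+ zero    f g = refl
Σ<-+ (suc m) f g = trans (cong (ℤ._+ (f m ℤ.+ g m)) (Σ<-+ m f g)) (+-interchange (Σ< m f) (Σ< m g) (f m) (g m))

Σ<-*ˡ : ∀ m c (f : ℕ → ℤ) → Σ< m (λ j → c ℤ.* f j) ≡ c ℤ.* Σ< m f
Σ<-*ˡ zero    c f = sym (ℤP.*-zeroʳ c)
Σ<-*ˡ (suc m) c f =
  trans (cong (ℤ._+ c ℤ.* f m) (Σ<-*ˡ m c f)) (sym (ℤP.*-distribˡ-+ c (Σ< m f) (f m)))

Σ<-zero : ∀ m → Σ< m (λ _ → + 0) ≡ + 0
Σ<-zero zero    = refl
Σ<-zero (suc m) = cong (ℤ._+ + 0) (Σ<-zero m)

Σ<-swap : ∀ a b (f : ℕ → ℕ → ℤ) →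
  Σ< a (λ i → Σ< b (λ j → f i j)) ≡ Σ< b (λ j → Σ< a (λ i → f i j))
Σ<-swap zero    b f = sym (Σ<-zero b)
Σ<-swap (suc a) b f =
  trans (cong (ℤ._+ Σ< b (f a)) (Σ<-swap a b f)) (sym (Σ<-+ b _ (f a)))

Σ≤-Σ< : ∀ m (f : ℕ → ℤ) → Σ≤ m f ≡ Σ< (suc m) f
Σ≤-Σ< zero    f = sym (ℤP.+-identityˡ (f 0))
Σ≤-Σ< (suc m) f = cong (ℤ._+ f (suc m)) (Σ≤-Σ< m f)

Σ<-drop-last : ∀ r (w : ℕ → ℤ) →
  Σ< r (λ s → + (r C s) ℤ.* w s) ≡ Σ< (suc r) (λ s → + (r C s) ℤ.* w s) ℤ.- w r
Σ<-drop-last r w = begin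
  S                                 ≡⟨ add-and-subtract S (w r) ⟩
  S ℤ.+ + 1 ℤ.* w r ℤ.- w r         ≡⟨ cong (λ c → S ℤ.+ + c ℤ.* w r ℤ.- w r) (sym (nCn≡1 r)) ⟩
  S ℤ.+ + (r C r) ℤ.* w r ℤ.- w r   ∎
  where
  open ≡-Reasoning
  S : ℤ
  S = Σ< r (λ s → + (r C s) ℤ.* w s)
  add-and-subtract : ∀ x y → x ≡ x ℤ.+ + 1 ℤ.* y ℤ.- y
  add-and-subtract = solve-∀

pascal : ∀ r (w : ℕ → ℤ) →
  Σ< (suc (suc r)) (λ s → + (suc r C s) ℤ.* w s)
    ≡ Σ< (suc r) (λ s → + (r C s) ℤ.* w s) ℤ.+ Σ< (suc r) (λ s → + (r C s) ℤ.* w (suc s))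
pascal r w = begin
  Σ< (suc (suc r)) (λ s → + (suc r C s) ℤ.* w s)
    ≡⟨ Σ<-front (suc r) _ ⟩
  first ℤ.+ Σ< (suc r) (λ s → + (suc r C suc s) ℤ.* w (suc s))
    ≡⟨ cong (λ z → first ℤ.+ z) (Σ<-cong (suc r) λ s _ → split s) ⟩
  first ℤ.+ Σ< (suc r) (λ s → + (r C suc s) ℤ.* w (suc s) ℤ.+ + (r C s) ℤ.* w (suc s))
    ≡⟨ cong (λ z → first ℤ.+ z) (Σ<-+ (suc r) _ _) ⟩
  first ℤ.+ (Σ< r shifted ℤ.+ + (r C suc r) ℤ.* w (suc r) ℤ.+ Σ< (suc r) upper)
    ≡⟨ cong (λ c → first ℤ.+ (Σ< r shifted ℤ.+ + c ℤ.* w (suc r) ℤ.+ Σ< (suc r) upper))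
         (k>n⇒nCk≡0 (ℕP.n<1+n r)) ⟩
  first ℤ.+ (Σ< r shifted ℤ.+ + 0 ℤ.* w (suc r) ℤ.+ Σ< (suc r) upper)
    ≡⟨ regroup first (Σ< r shifted) (w (suc r)) (Σ< (suc r) upper) ⟩
  (first ℤ.+ Σ< r shifted) ℤ.+ Σ< (suc r) upper
    ≡⟨ cong (ℤ._+ Σ< (suc r) upper) (sym (Σ<-front r (λ s → + (r C s) ℤ.* w s))) ⟩
  Σ< (suc r) (λ s → + (r C s) ℤ.* w s) ℤ.+ Σ< (suc r) upper ∎
  where
  open ≡-Reasoning
  first : ℤ
  first = + 1 ℤ.* w 0
  shifted upper : ℕ → ℤ
  shifted s = + (r C suc s) ℤ.* w (suc s)
  upper   s = + (r C s) ℤ.* w (suc s)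
  split : ∀ s → + (suc r C suc s) ℤ.* w (suc s) ≡ shifted s ℤ.+ upper s
  split s = begin
    + (suc r C suc s) ℤ.* w (suc s)
      ≡⟨ cong (λ c → + c ℤ.* w (suc s)) (sym (nCk+nC[k+1]≡[n+1]C[k+1] r s)) ⟩
    + ((r C s) ℕ.+ (r C suc s)) ℤ.* w (suc s)
      ≡⟨ cong (ℤ._* w (suc s)) (ℤP.pos-+ (r C s) (r C suc s)) ⟩
    (+ (r C s) ℤ.+ + (r C suc s)) ℤ.* w (suc s)
      ≡⟨ distrib (+ (r C s)) (+ (r C suc s)) (w (suc s)) ⟩
    shifted s ℤ.+ upper s ∎
    where
    distrib : ∀ a b x → (a ℤ.+ b) ℤ.* x ≡ b ℤ.* x ℤ.+ a ℤ.* x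
    distrib = solve-∀
  regroup : ∀ a x b y → a ℤ.+ (x ℤ.+ + 0 ℤ.* b ℤ.+ y) ≡ (a ℤ.+ x) ℤ.+ y
  regroup = solve-∀

binomial : ∀ r x → Σ< (suc r) (λ s → + (r C s) ℤ.* + (x ℕ.^ s)) ≡ + (suc x ℕ.^ r)
binomial zero    x = refl
binomial (suc r) x = begin
  Σ< (suc (suc r)) (λ s → + (suc r C s) ℤ.* + (x ℕ.^ s))
    ≡⟨ pascal r (λ s → + (x ℕ.^ s)) ⟩
  S ℤ.+ Σ< (suc r) (λ s → + (r C s) ℤ.* + (x ℕ.* x ℕ.^ s))
    ≡⟨ cong (λ z → S ℤ.+ z) (Σ<-cong (suc r) λ s _ → pull-out (r C s) (x ℕ.^ s)) ⟩
  S ℤ.+ Σ< (suc r) (λ s → + x ℤ.* (+ (r C s) ℤ.* + (x ℕ.^ s)))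
    ≡⟨ cong (λ z → S ℤ.+ z) (Σ<-*ˡ (suc r) (+ x) _) ⟩
  S ℤ.+ + x ℤ.* S
    ≡⟨ cong (λ z → z ℤ.+ + x ℤ.* z) (binomial r x) ⟩
  + (suc x ℕ.^ r) ℤ.+ + x ℤ.* + (suc x ℕ.^ r)
    ≡⟨ cong (λ z → + (suc x ℕ.^ r) ℤ.+ z) (sym (ℤP.pos-* x (suc x ℕ.^ r))) ⟩
  + (suc x ℕ.^ r) ℤ.+ + (x ℕ.* suc x ℕ.^ r)
    ≡⟨ sym (ℤP.pos-+ (suc x ℕ.^ r) _) ⟩
  + (suc x ℕ.^ suc r) ∎
  where
  open ≡-Reasoning
  S : ℤ
  S = Σ< (suc r) (λ s → + (r C s) ℤ.* + (x ℕ.^ s))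
  pull-out : ∀ c p → + c ℤ.* + (x ℕ.* p) ≡ + x ℤ.* (+ c ℤ.* + p)
  pull-out c p = trans (cong (+ c ℤ.*_) (ℤP.pos-* x p)) (*-left-comm (+ c) (+ x) (+ p))

binomialTransform : ∀ r l (c : ℕ → ℤ) (a : ℕ → ℕ) →
  Σ< (suc r) (λ s → + (r C s) ℤ.* Σ< l (λ j → c j ℤ.* + (a j ℕ.^ s)))
    ≡ Σ< l (λ j → c j ℤ.* + (suc (a j) ℕ.^ r))
binomialTransform r l c a = begin
  Σ< (suc r) (λ s → + (r C s) ℤ.* Σ< l (λ j → c j ℤ.* + (a j ℕ.^ s)))
    ≡⟨ Σ<-cong (suc r) (λ s _ → sym (Σ<-*ˡ l (+ (r C s)) _)) ⟩
  Σ< (suc r) (λ s → Σ< l (λ j → + (r C s) ℤ.* (c j ℤ.* + (a j ℕ.^ s))))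
    ≡⟨ Σ<-swap (suc r) l _ ⟩
  Σ< l (λ j → Σ< (suc r) (λ s → + (r C s) ℤ.* (c j ℤ.* + (a j ℕ.^ s))))
    ≡⟨ Σ<-cong l (λ j _ → Σ<-cong (suc r) λ s _ → *-left-comm (+ (r C s)) (c j) _) ⟩
  Σ< l (λ j → Σ< (suc r) (λ s → c j ℤ.* (+ (r C s) ℤ.* + (a j ℕ.^ s))))
    ≡⟨ Σ<-cong l (λ j _ → trans (Σ<-*ˡ (suc r) (c j) _) (cong (c j ℤ.*_) (binomial r (a j)))) ⟩
  Σ< l (λ j → c j ℤ.* + (suc (a j) ℕ.^ r)) ∎
  where open ≡-Reasoning

alternatingPascal : ∀ l (v : ℕ → ℤ) →
  Σ< (suc (suc l)) (λ j → sgn j ℤ.* + (suc l C j) ℤ.* v j)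
    ≡ Σ< (suc l) (λ j → sgn j ℤ.* + (l C j) ℤ.* v j)
      ℤ.- Σ< (suc l) (λ j → sgn j ℤ.* + (l C j) ℤ.* v (suc j))
alternatingPascal l v = begin
  Σ< (suc (suc l)) (λ j → sgn j ℤ.* + (suc l C j) ℤ.* v j)
    ≡⟨ Σ<-cong (suc (suc l)) (λ j _ → reorder (sgn j) (+ (suc l C j)) (v j)) ⟩
  Σ< (suc (suc l)) (λ j → + (suc l C j) ℤ.* (sgn j ℤ.* v j))
    ≡⟨ pascal l (λ j → sgn j ℤ.* v j) ⟩
  Σ< (suc l) (λ j → + (l C j) ℤ.* (sgn j ℤ.* v j))
    ℤ.+ Σ< (suc l) (λ j → + (l C j) ℤ.* (ℤ.- sgn j ℤ.* v (suc j)))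
    ≡⟨ cong₂ ℤ._+_ (Σ<-cong (suc l) λ j _ → sym (reorder (sgn j) (+ (l C j)) (v j)))
                   (Σ<-cong (suc l) λ j _ → negate (sgn j) (+ (l C j)) (v (suc j))) ⟩
  Σ< (suc l) (λ j → sgn j ℤ.* + (l C j) ℤ.* v j)
    ℤ.+ Σ< (suc l) (λ j → ℤ.-1ℤ ℤ.* (sgn j ℤ.* + (l C j) ℤ.* v (suc j)))
    ≡⟨ cong (λ z → Σ< (suc l) (λ j → sgn j ℤ.* + (l C j) ℤ.* v j) ℤ.+ z)
         (trans (Σ<-*ˡ (suc l) ℤ.-1ℤ _) (ℤP.-1*i≡-i _)) ⟩
  Σ< (suc l) (λ j → sgn j ℤ.* + (l C j) ℤ.* v j)
    ℤ.- Σ< (suc l) (λ j → sgn j ℤ.* + (l C j) ℤ.* v (suc j)) ∎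
  where
  open ≡-Reasoning
  reorder : ∀ e c x → e ℤ.* c ℤ.* x ≡ c ℤ.* (e ℤ.* x)
  reorder = solve-∀
  negate : ∀ e c x → c ℤ.* (ℤ.- e ℤ.* x) ≡ ℤ.-1ℤ ℤ.* (e ℤ.* c ℤ.* x)
  negate = solve-∀

-- G l r counts the chains A ⊊ B₁ ⊊ ⋯ ⊊ B_l of subsets of a finite set
-- when A misses exactly r elements: B₁ misses some s < r of them.
G : ℕ → ℕ → ℤ
G zero    r = + 1
G (suc l) r = Σ< r (λ s → + (r C s) ℤ.* G l s)

closedG : ℕ → ℕ → ℤ
closedG l r = Σ< (suc l) (λ j → sgn j ℤ.* + (l C j) ℤ.* + (suc (l ∸ j) ℕ.^ r))

-- Proof by induction on l: the recursion for G becomes, after the binomial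
-- transform, Pascal's rule for the alternating sum closedG.
G≡closedG : ∀ l r → G l r ≡ closedG l r
G≡closedG zero    r = cong (λ p → + 0 ℤ.+ + 1 ℤ.* + p) (sym (ℕP.^-zeroˡ r))
G≡closedG (suc l) r = begin
  Σ< r (λ s → + (r C s) ℤ.* G l s)
    ≡⟨ Σ<-cong r (λ s _ → cong (+ (r C s) ℤ.*_) (G≡closedG l s)) ⟩
  Σ< r (λ s → + (r C s) ℤ.* closedG l s)
    ≡⟨ Σ<-drop-last r (closedG l) ⟩
  Σ< (suc r) (λ s → + (r C s) ℤ.* closedG l s) ℤ.- closedG l r
    ≡⟨ cong (ℤ._- closedG l r)
         (binomialTransform r (suc l) (λ j → sgn j ℤ.* + (l C j)) (λ j → suc (l ∸ j))) ⟩
  Σ< (suc l) (λ j → sgn j ℤ.* + (l C j) ℤ.* + (suc (suc (l ∸ j)) ℕ.^ r)) ℤ.- closedG l r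
    ≡⟨ cong (ℤ._- closedG l r) (Σ<-cong (suc l) λ j j≤l →
         cong (λ b → sgn j ℤ.* + (l C j) ℤ.* + (suc b ℕ.^ r))
              (sym (ℕP.+-∸-assoc 1 (ℕP.≤-pred j≤l)))) ⟩
  Σ< (suc l) (λ j → sgn j ℤ.* + (l C j) ℤ.* + (suc (suc l ∸ j) ℕ.^ r)) ℤ.- closedG l r
    ≡⟨ sym (alternatingPascal l (λ j → + (suc (suc l ∸ j) ℕ.^ r))) ⟩
  closedG (suc l) r ∎
  where open ≡-Reasoning

braidF : ℕ → ℕ → ℤ
braidF m a = Σ≤ a (λ b → sgn b ℤ.* + (a C b) ℤ.* + ((2 ℕ.+ (a ∸ b)) ℕ.^ m))

-- Choosing the first set of a chain in the m-cube (with s elements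
-- missing) and then the rest gives Σ_s C(m,s) G i s, which equals braidF.
braidFormula : ∀ m i → Σ< (suc m) (λ s → + (m C s) ℤ.* G i s) ≡ braidF m i
braidFormula m i = begin
  Σ< (suc m) (λ s → + (m C s) ℤ.* G i s)
    ≡⟨ Σ<-cong (suc m) (λ s _ → cong (+ (m C s) ℤ.*_) (G≡closedG i s)) ⟩
  Σ< (suc m) (λ s → + (m C s) ℤ.* closedG i s)
    ≡⟨ binomialTransform m (suc i) (λ j → sgn j ℤ.* + (i C j)) (λ j → suc (i ∸ j)) ⟩
  Σ< (suc i) (λ j → sgn j ℤ.* + (i C j) ℤ.* + ((2 ℕ.+ (i ∸ j)) ℕ.^ m))
    ≡⟨ sym (Σ≤-Σ< i _) ⟩
  braidF m i ∎
  where open ≡-Reasoning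

sgn-+ : ∀ a b → sgn (a ℕ.+ b) ≡ sgn a ℤ.* sgn b
sgn-+ zero    b = sym (ℤP.*-identityˡ (sgn b))
sgn-+ (suc a) b = trans (cong ℤ.-_ (sgn-+ a b)) (ℤP.neg-distribˡ-* (sgn a) (sgn b))

hFromF : ∀ {n} (F : Subset n) m → (∀ a → + fP F a ≡ braidF m a) →
  ∀ n' i → hP F n' i ≡ sgn i ℤ.* + (suc n' C i) ℤ.+
    Σ< i (λ a → Σ≤ a (λ b →
      sgn ((i ∸ a) ℕ.+ b ∸ 1) ℤ.* + ((n' ∸ a) C (i ∸ a ∸ 1)) ℤ.* + (a C b)
        ℤ.* + ((2 ℕ.+ (a ∸ b)) ℕ.^ m)))
hFromF F m f≡ n' i = begin
  hP F n' i                   ≡⟨ Σ≤-Σ< i term ⟩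
  Σ< (suc i) term             ≡⟨ Σ<-front i term ⟩
  term 0 ℤ.+ Σ< i (term ∘ suc) ≡⟨ cong₂ ℤ._+_ (ℤP.*-identityʳ (sgn i ℤ.* + (suc n' C i))) (Σ<-cong i expand) ⟩
  _ ∎
  where
  open ≡-Reasoning
  term : ℕ → ℤ
  term j = sgn (i ∸ j) ℤ.* + ((suc n' ∸ j) C (i ∸ j)) ℤ.* + fP₋ F j
  summand : ℕ → ℕ → ℤ
  summand a b = sgn ((i ∸ a) ℕ.+ b ∸ 1) ℤ.* + ((n' ∸ a) C (i ∸ a ∸ 1)) ℤ.* + (a C b)
                  ℤ.* + ((2 ℕ.+ (a ∸ b)) ℕ.^ m)
  peel : ∀ a → a < i → i ∸ a ≡ suc (i ∸ suc a)
  peel a a<i = ℕP.+-∸-assoc 1 a<i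
  index : ∀ a → a < i → i ∸ suc a ≡ i ∸ a ∸ 1
  index a a<i = sym (cong (_∸ 1) (peel a a<i))
  sign : ∀ a b → a < i → sgn (i ∸ suc a) ℤ.* sgn b ≡ sgn ((i ∸ a) ℕ.+ b ∸ 1)
  sign a b a<i = trans (sym (sgn-+ (i ∸ suc a) b))
    (cong (λ e → sgn (e ℕ.+ b ∸ 1)) (sym (peel a a<i)))
  expand : ∀ a → a < i → term (suc a) ≡ Σ≤ a (summand a)
  expand a a<i = begin
    K ℤ.* + fP F a                              ≡⟨ cong (K ℤ.*_) (f≡ a) ⟩
    K ℤ.* braidF m a                            ≡⟨ cong (K ℤ.*_) (Σ≤-Σ< a _) ⟩
    K ℤ.* Σ< (suc a) fa                         ≡⟨ sym (Σ<-*ˡ (suc a) K fa) ⟩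
    Σ< (suc a) (λ b → K ℤ.* fa b)               ≡⟨ Σ<-cong (suc a) (λ b _ → regroup b) ⟩
    Σ< (suc a) (summand a)                      ≡⟨ sym (Σ≤-Σ< a (summand a)) ⟩
    Σ≤ a (summand a) ∎
    where
    K : ℤ
    K = sgn (i ∸ suc a) ℤ.* + ((n' ∸ a) C (i ∸ suc a))
    fa : ℕ → ℤ
    fa b = sgn b ℤ.* + (a C b) ℤ.* + ((2 ℕ.+ (a ∸ b)) ℕ.^ m)
    reassoc : ∀ s c s' c' p → s ℤ.* c ℤ.* (s' ℤ.* c' ℤ.* p) ≡ s ℤ.* s' ℤ.* c ℤ.* c' ℤ.* p
    reassoc = solve-∀
    regroup : ∀ b → K ℤ.* fa b ≡ summand a b
    regroup b = trans (reassoc (sgn (i ∸ suc a)) (+ ((n' ∸ a) C (i ∸ suc a))) (sgn b) (+ (a C b)) _)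
      (cong₂ (λ s e → s ℤ.* + ((n' ∸ a) C e) ℤ.* + (a C b) ℤ.* + ((2 ℕ.+ (a ∸ b)) ℕ.^ m))
             (sign a b a<i) (index a a<i))

ΣL : ∀ {X : Set} → List X → (X → ℤ) → ℤ
ΣL []       f = + 0
ΣL (x ∷ xs) f = f x ℤ.+ ΣL xs f

ΣL-cong : ∀ {X : Set} (xs : List X) {f g : X → ℤ} → (∀ x → f x ≡ g x) → ΣL xs f ≡ ΣL xs g
ΣL-cong []       f≡g = refl
ΣL-cong (x ∷ xs) f≡g = cong₂ ℤ._+_ (f≡g x) (ΣL-cong xs f≡g)

ΣL-++ : ∀ {X : Set} (xs ys : List X) f → ΣL (xs ++ ys) f ≡ ΣL xs f ℤ.+ ΣL ys f
ΣL-++ []       ys f = sym (ℤP.+-identityˡ (ΣL ys f))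
ΣL-++ (x ∷ xs) ys f = trans (cong (λ z → f x ℤ.+ z) (ΣL-++ xs ys f)) (sym (ℤP.+-assoc (f x) _ _))

ΣL-map : ∀ {X Y : Set} (g : X → Y) (xs : List X) f → ΣL (map g xs) f ≡ ΣL xs (f ∘ g)
ΣL-map g []       f = refl
ΣL-map g (x ∷ xs) f = cong (λ z → f (g x) ℤ.+ z) (ΣL-map g xs f)

ΣL-concatMap : ∀ {X Y : Set} (g : X → List Y) (xs : List X) f →
  ΣL (concatMap g xs) f ≡ ΣL xs (λ x → ΣL (g x) f)
ΣL-concatMap g []       f = refl
ΣL-concatMap g (x ∷ xs) f =
  trans (ΣL-++ (g x) (concatMap g xs) f) (cong (λ z → ΣL (g x) f ℤ.+ z) (ΣL-concatMap g xs f))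

ΣL-+ : ∀ {X : Set} (xs : List X) f g → ΣL xs (λ x → f x ℤ.+ g x) ≡ ΣL xs f ℤ.+ ΣL xs g
ΣL-+ []       f g = refl
ΣL-+ (x ∷ xs) f g =
  trans (cong (λ z → f x ℤ.+ g x ℤ.+ z) (ΣL-+ xs f g)) (+-interchange (f x) (g x) (ΣL xs f) (ΣL xs g))

ΣL-*ˡ : ∀ {X : Set} (xs : List X) c f → ΣL xs (λ x → c ℤ.* f x) ≡ c ℤ.* ΣL xs f
ΣL-*ˡ []       c f = sym (ℤP.*-zeroʳ c)
ΣL-*ˡ (x ∷ xs) c f =
  trans (cong (λ z → c ℤ.* f x ℤ.+ z) (ΣL-*ˡ xs c f)) (sym (ℤP.*-distribˡ-+ c (f x) (ΣL xs f)))

𝟙 : ∀ {P : Set} → Dec P → ℤ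
𝟙 d = if does d then + 1 else + 0

𝟙-yes : ∀ {P : Set} (p : Dec P) → P → 𝟙 p ≡ + 1
𝟙-yes (yes _) _  = refl
𝟙-yes (no ¬p) p  = contradiction p ¬p

𝟙-no : ∀ {P : Set} (p : Dec P) → ¬ P → 𝟙 p ≡ + 0
𝟙-no (yes p) ¬p = contradiction p ¬p
𝟙-no (no _)  _  = refl

𝟙-⇔ : ∀ {P Q : Set} (p : Dec P) (q : Dec Q) → (P → Q) → (Q → P) → 𝟙 p ≡ 𝟙 q
𝟙-⇔ (yes p) q P→Q _   = sym (𝟙-yes q (P→Q p))
𝟙-⇔ (no ¬p) q _   Q→P = sym (𝟙-no q (¬p ∘ Q→P))

𝟙-× : ∀ {P Q : Set} (p : Dec P) (q : Dec Q) → 𝟙 (p ×-dec q) ≡ 𝟙 p ℤ.* 𝟙 q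
𝟙-× (yes _) (yes _) = refl
𝟙-× (yes _) (no _)  = refl
𝟙-× (no _)  q       = refl

𝟙-idem : ∀ {P : Set} (p : Dec P) → 𝟙 p ℤ.* 𝟙 p ≡ 𝟙 p
𝟙-idem (yes _) = refl
𝟙-idem (no _)  = refl

𝟙-⊎ : ∀ {P Q R : Set} (p : Dec P) (q : Dec Q) (r : Dec R) →
  (R → P ⊎ Q) → (P → R) → (Q → R) → ¬ (P × Q) → 𝟙 r ≡ 𝟙 p ℤ.+ 𝟙 q
𝟙-⊎ (yes p) (yes q) _ _ _ _ excl = contradiction (p , q) excl
𝟙-⊎ (yes p) (no _)  r _ P→R _ _ = 𝟙-yes r (P→R p)
𝟙-⊎ (no _)  (yes q) r _ _ Q→R _ = 𝟙-yes r (Q→R q)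
𝟙-⊎ (no ¬p) (no ¬q) r R→P⊎Q _ _ _ = 𝟙-no r λ x → [ ¬p , ¬q ]′ (R→P⊎Q x)

𝟙-yes-* : ∀ {P : Set} (p : Dec P) → P → ∀ x → 𝟙 p ℤ.* x ≡ x
𝟙-yes-* p P x = trans (cong (ℤ._* x) (𝟙-yes p P)) (ℤP.*-identityˡ x)

length-filter : ∀ {X : Set} {P : X → Set} (P? : ∀ x → Dec (P x)) xs →
  + length (filter P? xs) ≡ ΣL xs (𝟙 ∘ P?)
length-filter P? []       = refl
length-filter P? (x ∷ xs) with P? x
... | yes _ = cong (λ z → + 1 ℤ.+ z) (length-filter P? xs)
... | no _  = trans (length-filter P? xs) (sym (ℤP.+-identityˡ _))

ΣL-allSubsets : ∀ n (h : Subset (suc n) → ℤ) →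
  ΣL (allSubsets (suc n)) h
    ≡ ΣL (allSubsets n) (λ B → h (inside ∷ B)) ℤ.+ ΣL (allSubsets n) (λ B → h (outside ∷ B))
ΣL-allSubsets n h = trans (ΣL-++ (map (inside ∷_) (allSubsets n)) _ h)
  (cong₂ ℤ._+_ (ΣL-map (inside ∷_) (allSubsets n) h) (ΣL-map (outside ∷_) (allSubsets n) h))

ΣL-zero : ∀ {X : Set} (xs : List X) → ΣL xs (λ _ → + 0) ≡ + 0
ΣL-zero []       = refl
ΣL-zero (x ∷ xs) = trans (ℤP.+-identityˡ _) (ΣL-zero xs)

_≟ˢ_ : ∀ {n} → DecidableEquality (Subset n)
_≟ˢ_ = VecP.≡-dec Bool._≟_

ΣL-delta : ∀ {m} (B : Subset m) (g : Subset m → ℤ) →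
  ΣL (allSubsets m) (λ D → 𝟙 (B ≟ˢ D) ℤ.* g D) ≡ g B
ΣL-delta []              g = trans (ℤP.+-identityʳ _) (ℤP.*-identityˡ (g []))
ΣL-delta {suc m} (inside ∷ B)  g = begin
  ΣL (allSubsets (suc m)) (λ D → 𝟙 ((inside ∷ B) ≟ˢ D) ℤ.* g D)
    ≡⟨ ΣL-allSubsets m _ ⟩
  ΣL (allSubsets m) (λ D → 𝟙 (B ≟ˢ D) ℤ.* g (inside ∷ D)) ℤ.+ ΣL (allSubsets m) (λ D → + 0 ℤ.* g (outside ∷ D))
    ≡⟨ cong₂ ℤ._+_ (ΣL-delta B (g ∘ (inside ∷_))) (ΣL-zero (allSubsets m)) ⟩
  g (inside ∷ B) ℤ.+ + 0
    ≡⟨ ℤP.+-identityʳ _ ⟩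
  g (inside ∷ B) ∎
  where open ≡-Reasoning
ΣL-delta {suc m} (outside ∷ B) g = begin
  ΣL (allSubsets (suc m)) (λ D → 𝟙 ((outside ∷ B) ≟ˢ D) ℤ.* g D)
    ≡⟨ ΣL-allSubsets m _ ⟩
  ΣL (allSubsets m) (λ D → + 0 ℤ.* g (inside ∷ D)) ℤ.+ ΣL (allSubsets m) (λ D → 𝟙 (B ≟ˢ D) ℤ.* g (outside ∷ D))
    ≡⟨ cong₂ ℤ._+_ (ΣL-zero (allSubsets m)) (ΣL-delta B (g ∘ (outside ∷_))) ⟩
  + 0 ℤ.+ g (outside ∷ B)
    ≡⟨ ℤP.+-identityˡ _ ⟩
  g (outside ∷ B) ∎
  where open ≡-Reasoning

-- Summing a function of |∁D| over the supersets D of A: the supersets of A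
-- missing s elements correspond to the s-subsets of ∁A.
superset-sum : ∀ {m} (A : Subset m) (w : ℕ → ℤ) →
  ΣL (allSubsets m) (λ D → 𝟙 (A ⊆? D) ℤ.* w (∣ ∁ D ∣))
    ≡ Σ< (suc ∣ ∁ A ∣) (λ s → + (∣ ∁ A ∣ C s) ℤ.* w s)
superset-sum []                    w = ℤP.+-comm (+ 1 ℤ.* w 0) (+ 0)
superset-sum {suc m} (inside ∷ A)  w = begin
  ΣL (allSubsets (suc m)) (λ D → 𝟙 ((inside ∷ A) ⊆? D) ℤ.* w (∣ ∁ D ∣))
    ≡⟨ ΣL-allSubsets m _ ⟩
  ΣL (allSubsets m) (λ D → 𝟙 (A ⊆? D) ℤ.* w (∣ ∁ D ∣)) ℤ.+ ΣL (allSubsets m) (λ D → + 0 ℤ.* w (suc ∣ ∁ D ∣))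
    ≡⟨ cong₂ ℤ._+_ (superset-sum A w) (ΣL-zero (allSubsets m)) ⟩
  Σ< (suc ∣ ∁ A ∣) (λ s → + (∣ ∁ A ∣ C s) ℤ.* w s) ℤ.+ + 0
    ≡⟨ ℤP.+-identityʳ _ ⟩
  Σ< (suc ∣ ∁ A ∣) (λ s → + (∣ ∁ A ∣ C s) ℤ.* w s) ∎
  where open ≡-Reasoning
superset-sum {suc m} (outside ∷ A) w = begin
  ΣL (allSubsets (suc m)) (λ D → 𝟙 ((outside ∷ A) ⊆? D) ℤ.* w (∣ ∁ D ∣))
    ≡⟨ ΣL-allSubsets m _ ⟩
  ΣL (allSubsets m) (λ D → 𝟙 (A ⊆? D) ℤ.* w (∣ ∁ D ∣))
    ℤ.+ ΣL (allSubsets m) (λ D → 𝟙 (A ⊆? D) ℤ.* w (suc ∣ ∁ D ∣))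
    ≡⟨ cong₂ ℤ._+_ (superset-sum A w) (superset-sum A (w ∘ suc)) ⟩
  Σ< (suc ∣ ∁ A ∣) (λ s → + (∣ ∁ A ∣ C s) ℤ.* w s)
    ℤ.+ Σ< (suc ∣ ∁ A ∣) (λ s → + (∣ ∁ A ∣ C s) ℤ.* w (suc s))
    ≡⟨ sym (pascal ∣ ∁ A ∣ w) ⟩
  Σ< (suc (suc ∣ ∁ A ∣)) (λ s → + (suc ∣ ∁ A ∣ C s) ℤ.* w s) ∎
  where open ≡-Reasoning

⊂⇒≢ : ∀ {m} {A D : Subset m} → A ⊂ D → A ≢ D
⊂⇒≢ (_ , x , x∈D , x∉A) refl = x∉A x∈D

⊆∧≢⇒⊂ : ∀ {m} {A D : Subset m} → A ⊆ D → A ≢ D → A ⊂ D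
⊆∧≢⇒⊂ {A = A} {D} A⊆D A≢D with any? (λ x → (x ∈? D) ×-dec ¬? (x ∈? A))
... | yes (x , x∈D , x∉A) = A⊆D , x , x∈D , x∉A
... | no  ∄x = contradiction (⊆-antisym A⊆D D⊆A) A≢D
  where
  D⊆A : D ⊆ A
  D⊆A {x} x∈D with x ∈? A
  ... | yes x∈A = x∈A
  ... | no  x∉A = contradiction (x , x∈D , x∉A) ∄x

𝟙-⊆ : ∀ {m} (A D : Subset m) → 𝟙 (A ⊆? D) ≡ 𝟙 (A ⊂? D) ℤ.+ 𝟙 (A ≟ˢ D)
𝟙-⊆ A D = 𝟙-⊎ (A ⊂? D) (A ≟ˢ D) (A ⊆? D) split proj₁ ⊆-reflexive (λ (A⊂D , A≡D) → ⊂⇒≢ A⊂D A≡D)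
  where
  split : A ⊆ D → A ⊂ D ⊎ A ≡ D
  split A⊆D with A ≟ˢ D
  ... | yes A≡D = inj₂ A≡D
  ... | no  A≢D = inj₁ (⊆∧≢⇒⊂ A⊆D A≢D)

strict-superset-sum : ∀ {m} (A : Subset m) (w : ℕ → ℤ) →
  ΣL (allSubsets m) (λ D → 𝟙 (A ⊂? D) ℤ.* w (∣ ∁ D ∣))
    ≡ Σ< ∣ ∁ A ∣ (λ s → + (∣ ∁ A ∣ C s) ℤ.* w s)
strict-superset-sum {m} A w = begin
  Strict                                                ≡⟨ add-and-subtract Strict Equal ⟩
  Strict ℤ.+ Equal ℤ.- Equal                            ≡⟨ cong₂ ℤ._-_ strict+equal (ΣL-delta A (w ∘ ∣_∣ ∘ ∁)) ⟩
  ΣL (allSubsets m) (λ D → 𝟙 (A ⊆? D) ℤ.* w (∣ ∁ D ∣)) ℤ.- w r ≡⟨ cong (ℤ._- w r) (superset-sum A w) ⟩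
  Σ< (suc r) (λ s → + (r C s) ℤ.* w s) ℤ.- w r          ≡⟨ sym (Σ<-drop-last r w) ⟩
  Σ< r (λ s → + (r C s) ℤ.* w s) ∎
  where
  open ≡-Reasoning
  r : ℕ
  r = ∣ ∁ A ∣
  Strict Equal : ℤ
  Strict = ΣL (allSubsets m) (λ D → 𝟙 (A ⊂? D) ℤ.* w (∣ ∁ D ∣))
  Equal  = ΣL (allSubsets m) (λ D → 𝟙 (A ≟ˢ D) ℤ.* w (∣ ∁ D ∣))
  strict+equal : Strict ℤ.+ Equal ≡ ΣL (allSubsets m) (λ D → 𝟙 (A ⊆? D) ℤ.* w (∣ ∁ D ∣))
  strict+equal = trans (sym (ΣL-+ (allSubsets m) _ _)) (ΣL-cong (allSubsets m) λ D →
    trans (sym (ℤP.*-distribʳ-+ (w (∣ ∁ D ∣)) (𝟙 (A ⊂? D)) _)) (cong (ℤ._* w (∣ ∁ D ∣)) (sym (𝟙-⊆ A D))))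
  add-and-subtract : ∀ x y → x ≡ x ℤ.+ y ℤ.- y
  add-and-subtract = solve-∀

∷-⊆⁺ : ∀ {m} {s t} {p q : Subset m} → (s ≡ inside → t ≡ inside) → p ⊆ q → s ∷ p ⊆ t ∷ q
∷-⊆⁺ {s = outside}                s→t p⊆q = out⊆ p⊆q
∷-⊆⁺ {s = inside}  {t = inside}  s→t p⊆q = in⊆in p⊆q
∷-⊆⁺ {s = inside}  {t = outside} s→t p⊆q = contradiction (s→t refl) λ ()

∷-⊆⁻ : ∀ {m} {s t} {p q : Subset m} → s ∷ p ⊆ t ∷ q → s ≡ inside → t ≡ inside
∷-⊆⁻ sp⊆tq refl = VecP.[]=⇒lookup (sp⊆tq here)

ConstOn : ∀ {n} → Subset n → Bool → Subset n → Set
ConstOn F c A = ∀ v → v ∈ F → lookup A v ≡ c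

ConstOn? : ∀ {n} (F : Subset n) c A → Dec (ConstOn F c A)
ConstOn? F c A = all? λ v → (v ∈? F) →-dec (lookup A v Bool.≟ c)

-- The vertices of P_F constant c on F correspond to all subsets of ∁F:
-- expand F c B puts c on F and B on ∁F, restrict F forgets F.
expand : ∀ {n} (F : Subset n) → Bool → Subset ∣ ∁ F ∣ → Subset n
expand []            c []      = []
expand (inside ∷ F)  c B       = c ∷ expand F c B
expand (outside ∷ F) c (b ∷ B) = b ∷ expand F c B

restrict : ∀ {n} (F : Subset n) → Subset n → Subset ∣ ∁ F ∣
restrict []            []      = []
restrict (inside ∷ F)  (a ∷ A) = restrict F A
restrict (outside ∷ F) (a ∷ A) = a ∷ restrict F A

expand-const : ∀ {n} (F : Subset n) c B → ConstOn F c (expand F c B)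
expand-const (inside ∷ F)  c B       zero    here        = refl
expand-const (inside ∷ F)  c B       (suc v) (there v∈F) = expand-const F c B v v∈F
expand-const (outside ∷ F) c (b ∷ B) (suc v) (there v∈F) = expand-const F c B v v∈F

restrict-expand : ∀ {n} (F : Subset n) c B → restrict F (expand F c B) ≡ B
restrict-expand []            c []      = refl
restrict-expand (inside ∷ F)  c B       = restrict-expand F c B
restrict-expand (outside ∷ F) c (b ∷ B) = cong (b ∷_) (restrict-expand F c B)

expand-restrict : ∀ {n} (F : Subset n) c A → ConstOn F c A → expand F c (restrict F A) ≡ A
expand-restrict []            c []      _     = refl
expand-restrict (inside ∷ F)  c (a ∷ A) const =
  cong₂ _∷_ (sym (const zero here)) (expand-restrict F c A (λ v v∈F → const (suc v) (there v∈F)))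
expand-restrict (outside ∷ F) c (a ∷ A) const =
  cong (a ∷_) (expand-restrict F c A (λ v v∈F → const (suc v) (there v∈F)))

expand-mono : ∀ {n} (F : Subset n) {c d B D} →
  (c ≡ inside → d ≡ inside) → B ⊆ D → expand F c B ⊆ expand F d D
expand-mono []            c→d B⊆D ()
expand-mono (inside ∷ F)  c→d B⊆D = ∷-⊆⁺ c→d (expand-mono F c→d B⊆D)
expand-mono (outside ∷ F) {B = b ∷ B} {D = d ∷ D} c→d bB⊆dD =
  ∷-⊆⁺ (∷-⊆⁻ bB⊆dD) (expand-mono F c→d (drop-∷-⊆ bB⊆dD))

restrict-mono : ∀ {n} (F : Subset n) {A A'} → A ⊆ A' → restrict F A ⊆ restrict F A'
restrict-mono []            {[]}    {[]}      A⊆A' ()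
restrict-mono (inside ∷ F)  {a ∷ A} {a' ∷ A'} aA⊆aA' = restrict-mono F (drop-∷-⊆ aA⊆aA')
restrict-mono (outside ∷ F) {a ∷ A} {a' ∷ A'} aA⊆aA' =
  ∷-⊆⁺ (∷-⊆⁻ aA⊆aA') (restrict-mono F (drop-∷-⊆ aA⊆aA'))

ConstOn-tail : ∀ {n} {s} {F : Subset n} {c a A} → ConstOn (s ∷ F) c (a ∷ A) → ConstOn F c A
ConstOn-tail const v v∈F = const (suc v) (there v∈F)

𝟙-ConstOn-inside : ∀ {n} (F : Subset n) c a A →
  𝟙 (ConstOn? (inside ∷ F) c (a ∷ A)) ≡ 𝟙 (a Bool.≟ c) ℤ.* 𝟙 (ConstOn? F c A)
𝟙-ConstOn-inside F c a A = trans
  (𝟙-⇔ (ConstOn? (inside ∷ F) c (a ∷ A)) ((a Bool.≟ c) ×-dec ConstOn? F c A)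
    (λ const → const zero here , ConstOn-tail const)
    (λ { (a≡c , const) zero here → a≡c ; (a≡c , const) (suc v) (there v∈F) → const v v∈F }))
  (𝟙-× (a Bool.≟ c) (ConstOn? F c A))

𝟙-ConstOn-outside : ∀ {n} (F : Subset n) c a A →
  𝟙 (ConstOn? (outside ∷ F) c (a ∷ A)) ≡ 𝟙 (ConstOn? F c A)
𝟙-ConstOn-outside F c a A = 𝟙-⇔ (ConstOn? (outside ∷ F) c (a ∷ A)) (ConstOn? F c A)
  ConstOn-tail (λ { const (suc v) (there v∈F) → const v v∈F })

ΣL-head : ∀ n c (h : Bool → Subset n → ℤ) →
  ΣL (allSubsets n) (λ A → 𝟙 (inside Bool.≟ c) ℤ.* h inside A)
    ℤ.+ ΣL (allSubsets n) (λ A → 𝟙 (outside Bool.≟ c) ℤ.* h outside A)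
    ≡ ΣL (allSubsets n) (h c)
ΣL-head n true  h = trans (cong₂ ℤ._+_ (ΣL-cong (allSubsets n) λ A → ℤP.*-identityˡ (h inside A))
                                        (ΣL-zero (allSubsets n)))
                          (ℤP.+-identityʳ _)
ΣL-head n false h = trans (cong₂ ℤ._+_ (ΣL-zero (allSubsets n))
                                        (ΣL-cong (allSubsets n) λ A → ℤP.*-identityˡ (h outside A)))
                          (ℤP.+-identityˡ _)

constant-sum : ∀ {n} (F : Subset n) c (g : Subset n → ℤ) →
  ΣL (allSubsets n) (λ A → 𝟙 (ConstOn? F c A) ℤ.* g A) ≡ ΣL (allSubsets ∣ ∁ F ∣) (g ∘ expand F c)
constant-sum [] c g = cong (ℤ._+ + 0)
  (trans (cong (ℤ._* g []) (𝟙-yes (ConstOn? [] c []) λ _ ())) (ℤP.*-identityˡ (g [])))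
constant-sum {suc n} (inside ∷ F) c g = begin
  ΣL (allSubsets (suc n)) (λ A → 𝟙 (ConstOn? (inside ∷ F) c A) ℤ.* g A)
    ≡⟨ ΣL-allSubsets n _ ⟩
  ΣL (allSubsets n) (λ A → 𝟙 (ConstOn? (inside ∷ F) c (inside ∷ A)) ℤ.* g (inside ∷ A))
    ℤ.+ ΣL (allSubsets n) (λ A → 𝟙 (ConstOn? (inside ∷ F) c (outside ∷ A)) ℤ.* g (outside ∷ A))
    ≡⟨ cong₂ ℤ._+_ (ΣL-cong (allSubsets n) (split inside)) (ΣL-cong (allSubsets n) (split outside)) ⟩
  ΣL (allSubsets n) (λ A → 𝟙 (inside Bool.≟ c) ℤ.* h inside A)
    ℤ.+ ΣL (allSubsets n) (λ A → 𝟙 (outside Bool.≟ c) ℤ.* h outside A)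
    ≡⟨ ΣL-head n c h ⟩
  ΣL (allSubsets n) (h c)
    ≡⟨ constant-sum F c (g ∘ (c ∷_)) ⟩
  ΣL (allSubsets ∣ ∁ F ∣) (g ∘ expand (inside ∷ F) c) ∎
  where
  open ≡-Reasoning
  h : Bool → Subset n → ℤ
  h a A = 𝟙 (ConstOn? F c A) ℤ.* g (a ∷ A)
  split : ∀ a A → 𝟙 (ConstOn? (inside ∷ F) c (a ∷ A)) ℤ.* g (a ∷ A) ≡ 𝟙 (a Bool.≟ c) ℤ.* h a A
  split a A = trans (cong (ℤ._* g (a ∷ A)) (𝟙-ConstOn-inside F c a A))
                    (ℤP.*-assoc (𝟙 (a Bool.≟ c)) _ (g (a ∷ A)))
constant-sum {suc n} (outside ∷ F) c g = begin
  ΣL (allSubsets (suc n)) (λ A → 𝟙 (ConstOn? (outside ∷ F) c A) ℤ.* g A)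
    ≡⟨ ΣL-allSubsets n _ ⟩
  ΣL (allSubsets n) (λ A → 𝟙 (ConstOn? (outside ∷ F) c (inside ∷ A)) ℤ.* g (inside ∷ A))
    ℤ.+ ΣL (allSubsets n) (λ A → 𝟙 (ConstOn? (outside ∷ F) c (outside ∷ A)) ℤ.* g (outside ∷ A))
    ≡⟨ cong₂ ℤ._+_ (ΣL-cong (allSubsets n) (drop inside)) (ΣL-cong (allSubsets n) (drop outside)) ⟩
  ΣL (allSubsets n) (λ A → 𝟙 (ConstOn? F c A) ℤ.* g (inside ∷ A))
    ℤ.+ ΣL (allSubsets n) (λ A → 𝟙 (ConstOn? F c A) ℤ.* g (outside ∷ A))
    ≡⟨ cong₂ ℤ._+_ (constant-sum F c (g ∘ (inside ∷_))) (constant-sum F c (g ∘ (outside ∷_))) ⟩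
  ΣL (allSubsets ∣ ∁ F ∣) (λ B → g (inside ∷ expand F c B))
    ℤ.+ ΣL (allSubsets ∣ ∁ F ∣) (λ B → g (outside ∷ expand F c B))
    ≡⟨ sym (ΣL-allSubsets ∣ ∁ F ∣ (g ∘ expand (outside ∷ F) c)) ⟩
  ΣL (allSubsets (suc ∣ ∁ F ∣)) (g ∘ expand (outside ∷ F) c) ∎
  where
  open ≡-Reasoning
  drop : ∀ a A → 𝟙 (ConstOn? (outside ∷ F) c (a ∷ A)) ℤ.* g (a ∷ A) ≡ 𝟙 (ConstOn? F c A) ℤ.* g (a ∷ A)
  drop a A = cong (ℤ._* g (a ∷ A)) (𝟙-ConstOn-outside F c a A)

chainsFrom : ∀ {n} → Subset n → ℕ → Subset n → ℤ
chainsFrom {n} F l A = ΣL (listsOfLength n l) (λ L → 𝟙 (StrictChainIn? F (A ∷ L)))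

fP-chainsFrom : ∀ {n} (F : Subset n) i → + fP F i ≡ ΣL (allSubsets n) (chainsFrom F i)
fP-chainsFrom {n} F i = begin
  + fP F i
    ≡⟨ length-filter (StrictChainIn? F) (listsOfLength n (suc i)) ⟩
  ΣL (listsOfLength n (suc i)) (𝟙 ∘ StrictChainIn? F)
    ≡⟨ ΣL-concatMap (λ A → map (A ∷_) (listsOfLength n i)) (allSubsets n) _ ⟩
  ΣL (allSubsets n) (λ A → ΣL (map (A ∷_) (listsOfLength n i)) (𝟙 ∘ StrictChainIn? F))
    ≡⟨ ΣL-cong (allSubsets n) (λ A → ΣL-map (A ∷_) (listsOfLength n i) _) ⟩
  ΣL (allSubsets n) (chainsFrom F i) ∎
  where open ≡-Reasoning

chainsFrom-zero : ∀ {n} (F : Subset n) A → chainsFrom F 0 A ≡ 𝟙 (InH? F A)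
chainsFrom-zero F A = trans (ℤP.+-identityʳ _)
  (𝟙-⇔ (StrictChainIn? F (A ∷ [])) (InH? F A)
    (λ { (_ , inH ∷ᵃ []ᵃ) → inH }) (λ inH → [-] , inH ∷ᵃ []ᵃ))

chainsFrom-suc : ∀ {n} (F : Subset n) l A →
  chainsFrom F (suc l) A ≡ 𝟙 (InH? F A) ℤ.* ΣL (allSubsets n) (λ B → 𝟙 (A ⊂? B) ℤ.* chainsFrom F l B)
chainsFrom-suc {n} F l A = begin
  chainsFrom F (suc l) A
    ≡⟨ ΣL-concatMap (λ B → map (B ∷_) (listsOfLength n l)) (allSubsets n) _ ⟩
  ΣL (allSubsets n) (λ B → ΣL (map (B ∷_) (listsOfLength n l)) (λ L → 𝟙 (StrictChainIn? F (A ∷ L))))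
    ≡⟨ ΣL-cong (allSubsets n) (λ B → trans (ΣL-map (B ∷_) (listsOfLength n l) _)
         (trans (ΣL-cong (listsOfLength n l) (split B)) (ΣL-*ˡ (listsOfLength n l) (𝟙 (InH? F A) ℤ.* 𝟙 (A ⊂? B))
           (λ L → 𝟙 (StrictChainIn? F (B ∷ L)))))) ⟩
  ΣL (allSubsets n) (λ B → 𝟙 (InH? F A) ℤ.* 𝟙 (A ⊂? B) ℤ.* chainsFrom F l B)
    ≡⟨ ΣL-cong (allSubsets n) (λ B → ℤP.*-assoc (𝟙 (InH? F A)) (𝟙 (A ⊂? B)) (chainsFrom F l B)) ⟩
  ΣL (allSubsets n) (λ B → 𝟙 (InH? F A) ℤ.* (𝟙 (A ⊂? B) ℤ.* chainsFrom F l B))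
    ≡⟨ ΣL-*ˡ (allSubsets n) (𝟙 (InH? F A)) (λ B → 𝟙 (A ⊂? B) ℤ.* chainsFrom F l B) ⟩
  𝟙 (InH? F A) ℤ.* ΣL (allSubsets n) (λ B → 𝟙 (A ⊂? B) ℤ.* chainsFrom F l B) ∎
  where
  open ≡-Reasoning
  split : ∀ B L → 𝟙 (StrictChainIn? F (A ∷ B ∷ L))
                    ≡ 𝟙 (InH? F A) ℤ.* 𝟙 (A ⊂? B) ℤ.* 𝟙 (StrictChainIn? F (B ∷ L))
  split B L = trans
    (𝟙-⇔ (StrictChainIn? F (A ∷ B ∷ L)) ((InH? F A ×-dec (A ⊂? B)) ×-dec StrictChainIn? F (B ∷ L))
      (λ { (A⊂B ∷ linked , inH ∷ᵃ inHs) → (inH , A⊂B) , linked , inHs })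
      (λ { ((inH , A⊂B) , linked , inHs) → A⊂B ∷ linked , inH ∷ᵃ inHs }))
    (trans (𝟙-× (InH? F A ×-dec (A ⊂? B)) (StrictChainIn? F (B ∷ L)))
           (cong (ℤ._* 𝟙 (StrictChainIn? F (B ∷ L))) (𝟙-× (InH? F A) (A ⊂? B))))

chainsFrom-vertex : ∀ {n} (F : Subset n) l A → chainsFrom F l A ≡ 𝟙 (InH? F A) ℤ.* chainsFrom F l A
chainsFrom-vertex F zero    A = trans (chainsFrom-zero F A)
  (trans (sym (𝟙-idem (InH? F A))) (cong (𝟙 (InH? F A) ℤ.*_) (sym (chainsFrom-zero F A))))
chainsFrom-vertex {n} F (suc l) A = begin
  chainsFrom F (suc l) A   ≡⟨ chainsFrom-suc F l A ⟩
  i ℤ.* S                  ≡⟨ cong (ℤ._* S) (sym (𝟙-idem (InH? F A))) ⟩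
  i ℤ.* i ℤ.* S            ≡⟨ ℤP.*-assoc i i S ⟩
  i ℤ.* (i ℤ.* S)          ≡⟨ cong (i ℤ.*_) (sym (chainsFrom-suc F l A)) ⟩
  i ℤ.* chainsFrom F (suc l) A ∎
  where
  open ≡-Reasoning
  i S : ℤ
  i = 𝟙 (InH? F A)
  S = ΣL (allSubsets n) (λ B → 𝟙 (A ⊂? B) ℤ.* chainsFrom F l B)

-- In the braid triangulation (F = ∅) every subset is a vertex.
⊥-vertex : ∀ {m} (B : Subset m) → InH ⊥ B
⊥-vertex B v _ v∈⊥ _ = contradiction v∈⊥ ∉⊥

∣∁⊥∣≡ : ∀ m → ∣ ∁ (⊥ {m}) ∣ ≡ m
∣∁⊥∣≡ zero    = refl
∣∁⊥∣≡ (suc m) = cong suc (∣∁⊥∣≡ m)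

braid-chainsFrom : ∀ {m} l (B : Subset m) → chainsFrom ⊥ l B ≡ G l ∣ ∁ B ∣
braid-chainsFrom zero    B = trans (chainsFrom-zero ⊥ B) (𝟙-yes (InH? ⊥ B) (⊥-vertex B))
braid-chainsFrom {m} (suc l) B = begin
  chainsFrom ⊥ (suc l) B
    ≡⟨ chainsFrom-suc ⊥ l B ⟩
  𝟙 (InH? ⊥ B) ℤ.* ΣL (allSubsets m) (λ D → 𝟙 (B ⊂? D) ℤ.* chainsFrom ⊥ l D)
    ≡⟨ 𝟙-yes-* (InH? ⊥ B) (⊥-vertex B) (ΣL (allSubsets m) (λ D → 𝟙 (B ⊂? D) ℤ.* chainsFrom ⊥ l D)) ⟩
  ΣL (allSubsets m) (λ D → 𝟙 (B ⊂? D) ℤ.* chainsFrom ⊥ l D)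
    ≡⟨ ΣL-cong (allSubsets m) (λ D → cong (𝟙 (B ⊂? D) ℤ.*_) (braid-chainsFrom l D)) ⟩
  ΣL (allSubsets m) (λ D → 𝟙 (B ⊂? D) ℤ.* G l ∣ ∁ D ∣)
    ≡⟨ strict-superset-sum B (G l) ⟩
  G (suc l) ∣ ∁ B ∣ ∎
  where open ≡-Reasoning

braid-fP : ∀ m i → + fP (⊥ {m}) i ≡ Σ< (suc m) (λ s → + (m C s) ℤ.* G i s)
braid-fP m i = begin
  + fP (⊥ {m}) i
    ≡⟨ fP-chainsFrom (⊥ {m}) i ⟩
  ΣL (allSubsets m) (chainsFrom ⊥ i)
    ≡⟨ ΣL-cong (allSubsets m) (λ B → trans (braid-chainsFrom i B) (sym (𝟙-⊥⊆ B))) ⟩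
  ΣL (allSubsets m) (λ B → 𝟙 (⊥ ⊆? B) ℤ.* G i ∣ ∁ B ∣)
    ≡⟨ superset-sum (⊥ {m}) (G i) ⟩
  Σ< (suc ∣ ∁ (⊥ {m}) ∣) (λ s → + (∣ ∁ (⊥ {m}) ∣ C s) ℤ.* G i s)
    ≡⟨ cong (λ r → Σ< (suc r) (λ s → + (r C s) ℤ.* G i s)) (∣∁⊥∣≡ m) ⟩
  Σ< (suc m) (λ s → + (m C s) ℤ.* G i s) ∎
  where
  open ≡-Reasoning
  𝟙-⊥⊆ : ∀ B → 𝟙 (⊥ ⊆? B) ℤ.* G i ∣ ∁ B ∣ ≡ G i ∣ ∁ B ∣
  𝟙-⊥⊆ B = 𝟙-yes-* (⊥ ⊆? B) ⊥⊆ (G i ∣ ∁ B ∣)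

AllPairs-map⇔ : ∀ {X Y : Set} {R : X → X → Set} {S : Y → Y → Set} (f : X → Y) →
  (∀ x y → R x y ⇔ S (f x) (f y)) → ∀ xs → AllPairs R xs ⇔ AllPairs S (map f xs)
AllPairs-map⇔ f R⇔S xs = mk⇔
  (λ rs → AllPairsP.map⁺ (AllPairs.map (λ {x} {y} → Equivalence.to (R⇔S x y)) rs))
  (λ ss → AllPairs.map (λ {x} {y} → Equivalence.from (R⇔S x y)) (AllPairsP.map⁻ ss))

module VertexMap {n} (F : Subset n) (v₀ : Fin n) (v₀∈F : v₀ ∈ F) where

  ψ : Subset (suc ∣ ∁ F ∣) → Subset n
  ψ (c ∷ B) = expand F c B

  φ : Subset n → Subset (suc ∣ ∁ F ∣)
  φ A = lookup A v₀ ∷ restrict F A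

  ψ-vertex : ∀ B → InH F (ψ B)
  ψ-vertex (c ∷ B) v w v∈F w∈F = trans (expand-const F c B v v∈F) (sym (expand-const F c B w w∈F))

  φ∘ψ : ∀ B → φ (ψ B) ≡ B
  φ∘ψ (c ∷ B) = cong₂ _∷_ (expand-const F c B v₀ v₀∈F) (restrict-expand F c B)

  ψ∘φ : ∀ A → InH F A → ψ (φ A) ≡ A
  ψ∘φ A inH = expand-restrict F (lookup A v₀) A (λ v v∈F → inH v v₀ v∈F v₀∈F)

  ψ-injective : ∀ {B D} → ψ B ≡ ψ D → B ≡ D
  ψ-injective {B} {D} eq = trans (sym (φ∘ψ B)) (trans (cong φ eq) (φ∘ψ D))

  ψ-⊆ : ∀ B D → B ⊆ D ⇔ ψ B ⊆ ψ D
  ψ-⊆ (c ∷ B) (d ∷ D) = mk⇔ to from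
    where
    head-mono : expand F c B ⊆ expand F d D → c ≡ inside → d ≡ inside
    head-mono ψ⊆ refl = trans (sym (expand-const F d D v₀ v₀∈F))
      (VecP.[]=⇒lookup (ψ⊆ (VecP.lookup⇒[]= v₀ _ (expand-const F c B v₀ v₀∈F))))
    tail-mono : restrict F (expand F c B) ⊆ restrict F (expand F d D) → B ⊆ D
    tail-mono rr rewrite restrict-expand F c B | restrict-expand F d D = rr

    to : c ∷ B ⊆ d ∷ D → expand F c B ⊆ expand F d D
    to cB⊆dD = expand-mono F (∷-⊆⁻ cB⊆dD) (drop-∷-⊆ cB⊆dD)
    from : expand F c B ⊆ expand F d D → c ∷ B ⊆ d ∷ D
    from ψ⊆ = ∷-⊆⁺ (head-mono ψ⊆) (tail-mono (restrict-mono F ψ⊆))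

  ψ-⊂ : ∀ B D → B ⊂ D ⇔ ψ B ⊂ ψ D
  ψ-⊂ B D = mk⇔ to from
    where
    to : B ⊂ D → ψ B ⊂ ψ D
    to B⊂D = ⊆∧≢⇒⊂ (Equivalence.to (ψ-⊆ B D) (proj₁ B⊂D)) (⊂⇒≢ B⊂D ∘ ψ-injective)
    from : ψ B ⊂ ψ D → B ⊂ D
    from ψ⊂ = ⊆∧≢⇒⊂ (Equivalence.from (ψ-⊆ B D) (proj₁ ψ⊂)) (⊂⇒≢ ψ⊂ ∘ cong ψ)

  𝟙-InH : ∀ A → 𝟙 (InH? F A) ≡ 𝟙 (ConstOn? F true A) ℤ.+ 𝟙 (ConstOn? F false A)
  𝟙-InH A = 𝟙-⊎ (ConstOn? F true A) (ConstOn? F false A) (InH? F A) value (const⇒InH true) (const⇒InH false)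
    (λ (t , f) → contradiction (trans (sym (t v₀ v₀∈F)) (f v₀ v₀∈F)) λ ())
    where
    const⇒InH : ∀ c → ConstOn F c A → InH F A
    const⇒InH c const v w v∈F w∈F = trans (const v v∈F) (sym (const w w∈F))
    value : InH F A → ConstOn F true A ⊎ ConstOn F false A
    value inH with lookup A v₀ in eq
    ... | true  = inj₁ λ v v∈F → trans (inH v v₀ v∈F v₀∈F) eq
    ... | false = inj₂ λ v v∈F → trans (inH v v₀ v∈F v₀∈F) eq

  vertex-sum : ∀ (g : Subset n → ℤ) →
    ΣL (allSubsets n) (λ A → 𝟙 (InH? F A) ℤ.* g A) ≡ ΣL (allSubsets (suc ∣ ∁ F ∣)) (g ∘ ψ)
  vertex-sum g = begin
    ΣL (allSubsets n) (λ A → 𝟙 (InH? F A) ℤ.* g A)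
      ≡⟨ ΣL-cong (allSubsets n) (λ A → trans (cong (ℤ._* g A) (𝟙-InH A))
                                            (ℤP.*-distribʳ-+ (g A) (𝟙 (ConstOn? F true A)) _)) ⟩
    ΣL (allSubsets n) (λ A → 𝟙 (ConstOn? F true A) ℤ.* g A ℤ.+ 𝟙 (ConstOn? F false A) ℤ.* g A)
      ≡⟨ ΣL-+ (allSubsets n) _ _ ⟩
    ΣL (allSubsets n) (λ A → 𝟙 (ConstOn? F true A) ℤ.* g A)
      ℤ.+ ΣL (allSubsets n) (λ A → 𝟙 (ConstOn? F false A) ℤ.* g A)
      ≡⟨ cong₂ ℤ._+_ (constant-sum F true g) (constant-sum F false g) ⟩
    ΣL (allSubsets ∣ ∁ F ∣) (g ∘ expand F true) ℤ.+ ΣL (allSubsets ∣ ∁ F ∣) (g ∘ expand F false)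
      ≡⟨ sym (ΣL-allSubsets ∣ ∁ F ∣ (g ∘ ψ)) ⟩
    ΣL (allSubsets (suc ∣ ∁ F ∣)) (g ∘ ψ) ∎
    where open ≡-Reasoning

  chainsFrom-ψ : ∀ l B → chainsFrom F l (ψ B) ≡ chainsFrom ⊥ l B
  chainsFrom-ψ zero    B = trans (chainsFrom-zero F (ψ B))
    (trans (𝟙-yes (InH? F (ψ B)) (ψ-vertex B))
           (sym (trans (chainsFrom-zero ⊥ B) (𝟙-yes (InH? ⊥ B) (⊥-vertex B)))))
  chainsFrom-ψ (suc l) B = begin
    chainsFrom F (suc l) (ψ B)
      ≡⟨ chainsFrom-suc F l (ψ B) ⟩
    𝟙 (InH? F (ψ B)) ℤ.* ΣL (allSubsets n) (λ A → 𝟙 (ψ B ⊂? A) ℤ.* chainsFrom F l A)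
      ≡⟨ 𝟙-yes-* (InH? F (ψ B)) (ψ-vertex B) _ ⟩
    ΣL (allSubsets n) (λ A → 𝟙 (ψ B ⊂? A) ℤ.* chainsFrom F l A)
      ≡⟨ ΣL-cong (allSubsets n) (λ A → only-vertices A) ⟩
    ΣL (allSubsets n) (λ A → 𝟙 (InH? F A) ℤ.* (𝟙 (ψ B ⊂? A) ℤ.* chainsFrom F l A))
      ≡⟨ vertex-sum (λ A → 𝟙 (ψ B ⊂? A) ℤ.* chainsFrom F l A) ⟩
    ΣL (allSubsets (suc ∣ ∁ F ∣)) (λ D → 𝟙 (ψ B ⊂? ψ D) ℤ.* chainsFrom F l (ψ D))
      ≡⟨ ΣL-cong (allSubsets (suc ∣ ∁ F ∣)) (λ D →
           cong₂ ℤ._*_ (𝟙-⇔ (ψ B ⊂? ψ D) (B ⊂? D) (Equivalence.from (ψ-⊂ B D)) (Equivalence.to (ψ-⊂ B D)))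
                       (chainsFrom-ψ l D)) ⟩
    ΣL (allSubsets (suc ∣ ∁ F ∣)) (λ D → 𝟙 (B ⊂? D) ℤ.* chainsFrom ⊥ l D)
      ≡⟨ sym (𝟙-yes-* (InH? ⊥ B) (⊥-vertex B) _) ⟩
    𝟙 (InH? ⊥ B) ℤ.* ΣL (allSubsets (suc ∣ ∁ F ∣)) (λ D → 𝟙 (B ⊂? D) ℤ.* chainsFrom ⊥ l D)
      ≡⟨ sym (chainsFrom-suc ⊥ l B) ⟩
    chainsFrom ⊥ (suc l) B ∎
    where
    open ≡-Reasoning
    only-vertices : ∀ A → 𝟙 (ψ B ⊂? A) ℤ.* chainsFrom F l A
                          ≡ 𝟙 (InH? F A) ℤ.* (𝟙 (ψ B ⊂? A) ℤ.* chainsFrom F l A)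
    only-vertices A = trans (cong (𝟙 (ψ B ⊂? A) ℤ.*_) (chainsFrom-vertex F l A))
                            (*-left-comm (𝟙 (ψ B ⊂? A)) (𝟙 (InH? F A)) (chainsFrom F l A))

  fP-invariant : ∀ i → + fP F i ≡ + fP (⊥ {suc ∣ ∁ F ∣}) i
  fP-invariant i = begin
    + fP F i
      ≡⟨ fP-chainsFrom F i ⟩
    ΣL (allSubsets n) (chainsFrom F i)
      ≡⟨ ΣL-cong (allSubsets n) (chainsFrom-vertex F i) ⟩
    ΣL (allSubsets n) (λ A → 𝟙 (InH? F A) ℤ.* chainsFrom F i A)
      ≡⟨ vertex-sum (chainsFrom F i) ⟩
    ΣL (allSubsets (suc ∣ ∁ F ∣)) (chainsFrom F i ∘ ψ)
      ≡⟨ ΣL-cong (allSubsets (suc ∣ ∁ F ∣)) (chainsFrom-ψ i) ⟩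
    ΣL (allSubsets (suc ∣ ∁ F ∣)) (chainsFrom ⊥ i)
      ≡⟨ sym (fP-chainsFrom (⊥ {suc ∣ ∁ F ∣}) i) ⟩
    + fP (⊥ {suc ∣ ∁ F ∣}) i ∎
    where open ≡-Reasoning

  IsChain-ψ : ∀ L → IsChain L ⇔ IsChain (map ψ L)
  IsChain-ψ []       = mk⇔ (λ ()) (λ ())
  IsChain-ψ (A ∷ As) = mk⇔
    (λ (u , c) → Equivalence.to (distinct (A ∷ As)) u , Equivalence.to (comparable (A ∷ As)) c)
    (λ (u , c) → Equivalence.from (distinct (A ∷ As)) u , Equivalence.from (comparable (A ∷ As)) c)
    where
    distinct : ∀ xs → AllPairs _≢_ xs ⇔ AllPairs _≢_ (map ψ xs)
    distinct = AllPairs-map⇔ ψ (λ B D → mk⇔ (λ B≢D → B≢D ∘ ψ-injective) (λ ψB≢ψD → ψB≢ψD ∘ cong ψ))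
    comparable : ∀ xs → AllPairs Comparable xs ⇔ AllPairs Comparable (map ψ xs)
    comparable = AllPairs-map⇔ ψ λ B D → mk⇔
      (Sum.map (Equivalence.to (ψ-⊆ B D)) (Equivalence.to (ψ-⊆ D B)))
      (Sum.map (Equivalence.from (ψ-⊆ B D)) (Equivalence.from (ψ-⊆ D B)))

  iso : IsoToBraid F (suc ∣ ∁ F ∣)
  iso = φ , ψ , ψ-vertex , φ∘ψ , ψ∘φ , chains
    where
    chains : ∀ L → All (InH F) L → (IsChain L → IsChain (map φ L)) × (IsChain (map φ L) → IsChain L)
    chains L inH = (Equivalence.from (IsChain-ψ (map φ L)) ∘ subst IsChain (sym ψφL)) ,
                   (subst IsChain ψφL ∘ Equivalence.to (IsChain-ψ (map φ L)))
      where
      ψφL : map ψ (map φ L) ≡ L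
      ψφL = trans (sym (ListP.map-∘ L)) (ListP.map-id-local (All.map (λ {A} → ψ∘φ A) inH))

ΣFin≡sum : ∀ {n} (f : Fin n → ℤ) → ΣFin f ≡ sum f
ΣFin≡sum {zero}  f = refl
ΣFin≡sum {suc n} f = cong (λ z → f zero ℤ.+ z) (ΣFin≡sum (f ∘ suc))

ΣFin-cong : ∀ {n} {f g : Fin n → ℤ} → (∀ i → f i ≡ g i) → ΣFin f ≡ ΣFin g
ΣFin-cong {zero}  f≡g = refl
ΣFin-cong {suc n} f≡g = cong₂ ℤ._+_ (f≡g zero) (ΣFin-cong (f≡g ∘ suc))

ΣFin-zero : ∀ {n} (f : Fin n → ℤ) → (∀ i → f i ≡ + 0) → ΣFin f ≡ + 0
ΣFin-zero {n} f f≡0 = trans (ΣFin-cong f≡0) (trans (ΣFin≡sum {n} (λ _ → + 0)) (sum-replicate-zero n))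

ΣFin-*ˡ : ∀ {n} c (f : Fin n → ℤ) → ΣFin (λ i → c ℤ.* f i) ≡ c ℤ.* ΣFin f
ΣFin-*ˡ c f = trans (ΣFin≡sum (λ i → c ℤ.* f i)) (sym (trans (cong (c ℤ.*_) (ΣFin≡sum f)) (*-distribˡ-sum c f)))

ΣFin-*ʳ : ∀ {n} c (f : Fin n → ℤ) → ΣFin (λ i → f i ℤ.* c) ≡ ΣFin f ℤ.* c
ΣFin-*ʳ c f = trans (ΣFin≡sum (λ i → f i ℤ.* c)) (sym (trans (cong (ℤ._* c) (ΣFin≡sum f)) (*-distribʳ-sum c f)))

ΣFin-swap : ∀ {m n} (f : Fin m → Fin n → ℤ) →
  ΣFin (λ i → ΣFin (λ j → f i j)) ≡ ΣFin (λ j → ΣFin (λ i → f i j))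
ΣFin-swap f = begin
  ΣFin (λ i → ΣFin (f i))
    ≡⟨ trans (ΣFin-cong (λ i → ΣFin≡sum (f i))) (ΣFin≡sum (λ i → sum (f i))) ⟩
  sum (λ i → sum (f i))
    ≡⟨ ∑-comm f ⟩
  sum (λ j → sum (λ i → f i j))
    ≡⟨ sym (trans (ΣFin-cong (λ j → ΣFin≡sum (λ i → f i j))) (ΣFin≡sum (λ j → sum (λ i → f i j)))) ⟩
  ΣFin (λ j → ΣFin (λ i → f i j)) ∎
  where open ≡-Reasoning

idM-suc : ∀ {n} (i j : Fin n) → idM {suc n} (suc i) (suc j) ≡ idM i j
idM-suc i j with i Fin.≟ j
... | yes refl = refl
... | no  _    = refl

idM-sum : ∀ {n} (a : Fin n) (x : Fin n → ℤ) → ΣFin (λ j → idM a j ℤ.* x j) ≡ x a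
idM-sum zero    x = trans (cong₂ ℤ._+_ (ℤP.*-identityˡ (x zero)) (ΣFin-zero _ (λ j → ℤP.*-zeroˡ (x (suc j)))))
                          (ℤP.+-identityʳ (x zero))
idM-sum (suc a) x = trans (cong₂ ℤ._+_ (ℤP.*-zeroˡ (x zero)) (ΣFin-cong (λ j → cong (ℤ._* x (suc j)) (idM-suc a j))))
                          (trans (ℤP.+-identityˡ _) (idM-sum a (x ∘ suc)))

mv-assoc : ∀ {n} (A B : Matrix n) (x : Fin n → ℤ) i → ((A ·ᴹ B) ·ᵛ x) i ≡ (A ·ᵛ (B ·ᵛ x)) i
mv-assoc A B x i = begin
  ΣFin (λ j → ΣFin (λ k → A i k ℤ.* B k j) ℤ.* x j)
    ≡⟨ ΣFin-cong (λ j → sym (ΣFin-*ʳ (x j) (λ k → A i k ℤ.* B k j))) ⟩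
  ΣFin (λ j → ΣFin (λ k → A i k ℤ.* B k j ℤ.* x j))
    ≡⟨ ΣFin-swap (λ j k → A i k ℤ.* B k j ℤ.* x j) ⟩
  ΣFin (λ k → ΣFin (λ j → A i k ℤ.* B k j ℤ.* x j))
    ≡⟨ ΣFin-cong (λ k → trans (ΣFin-cong (λ j → ℤP.*-assoc (A i k) (B k j) (x j)))
                              (ΣFin-*ˡ (A i k) (λ j → B k j ℤ.* x j))) ⟩
  ΣFin (λ k → A i k ℤ.* ΣFin (λ j → B k j ℤ.* x j)) ∎
  where open ≡-Reasoning

mv-cong : ∀ {n} (A : Matrix n) {x y : Fin n → ℤ} → (∀ k → x k ≡ y k) → ∀ i → (A ·ᵛ x) i ≡ (A ·ᵛ y) i
mv-cong A x≡y i = ΣFin-cong (λ k → cong (A i k ℤ.*_) (x≡y k))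

cancel : ∀ {n} (A A' : Matrix n) → (∀ i j → (A ·ᴹ A') i j ≡ idM i j) → ∀ (x : Fin n → ℤ) i →
  ((A ·ᴹ A') ·ᵛ x) i ≡ x i
cancel A A' AA'≡I x i = trans (ΣFin-cong (λ k → cong (ℤ._* x k) (AA'≡I i k))) (idM-sum i x)

GL-* : ∀ {n} (A B : Matrix n) → IsGLℤ A → IsGLℤ B → IsGLℤ (A ·ᴹ B)
GL-* A B (A' , AA' , A'A) (B' , BB' , B'B) = B' ·ᴹ A' , inverseʳ , inverseˡ
  where
  inverseʳ : ∀ i j → ((A ·ᴹ B) ·ᴹ (B' ·ᴹ A')) i j ≡ idM i j
  inverseʳ i j = trans (mv-assoc A B _ i)
    (trans (mv-cong A (λ k → sym (mv-assoc B B' (λ l → A' l j) k)) i)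
    (trans (mv-cong A (cancel B B' BB' (λ l → A' l j)) i) (AA' i j)))
  inverseˡ : ∀ i j → ((B' ·ᴹ A') ·ᴹ (A ·ᴹ B)) i j ≡ idM i j
  inverseˡ i j = trans (mv-assoc B' A' _ i)
    (trans (mv-cong B' (λ k → sym (mv-assoc A' A (λ l → B l j) k)) i)
    (trans (mv-cong B' (cancel A' A A'A (λ l → B l j)) i) (B'B i j)))

permM : ∀ {n} → Permutation n n → Matrix n
permM π i j = idM (π ⟨$⟩ʳ i) j

permM-mv : ∀ {n} (π : Permutation n n) (x : Fin n → ℤ) i → (permM π ·ᵛ x) i ≡ x (π ⟨$⟩ʳ i)
permM-mv π x i = idM-sum (π ⟨$⟩ʳ i) x

permM-GL : ∀ {n} (π : Permutation n n) → IsGLℤ (permM π)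
permM-GL π = permM (Perm.flip π)
  , (λ i j → trans (idM-sum (π ⟨$⟩ʳ i) (λ k → idM (π ⟨$⟩ˡ k) j)) (cong (λ k → idM k j) (Perm.inverseˡ π)))
  , (λ i j → trans (idM-sum (π ⟨$⟩ˡ i) (λ k → idM (π ⟨$⟩ʳ k) j)) (cong (λ k → idM k j) (Perm.inverseʳ π)))

-- The difference matrix, (Δ x)_i = x_i - x_{i+1} (with x_n = 0) ...
diffM : ∀ {n} → Matrix n
diffM zero    zero          = + 1
diffM zero    (suc zero)    = ℤ.-1ℤ
diffM zero    (suc (suc j)) = + 0
diffM (suc i) zero          = + 0
diffM (suc i) (suc j)       = diffM i j

-- ... and its inverse, the partial-sum matrix (Σ x)_i = x_i + ⋯ + x_{n-1}.
sumM : ∀ {n} → Matrix n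
sumM zero    j       = + 1
sumM (suc i) zero    = + 0
sumM (suc i) (suc j) = sumM i j

-- The first row of Δ applied to the tail of x gives -x_1 (or 0 if n = 1).
next : ∀ n → (Fin n → ℤ) → ℤ
next zero    y = + 0
next (suc n) y = ℤ.- y zero

diffM-row₀ : ∀ n (y : Fin n → ℤ) → ΣFin (λ k → diffM {suc n} zero (suc k) ℤ.* y k) ≡ next n y
diffM-row₀ zero    y = refl
diffM-row₀ (suc n) y = trans (cong₂ ℤ._+_ (ℤP.-1*i≡-i (y zero)) (ΣFin-zero _ (λ k → ℤP.*-zeroˡ (y (suc k)))))
                             (ℤP.+-identityʳ _)

diff∘sum : ∀ {n} (i j : Fin n) → (diffM ·ᴹ sumM) i j ≡ idM i j
diff∘sum {suc zero}    zero    zero    = refl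
diff∘sum {suc (suc n)} zero    zero    rewrite diffM-row₀ (suc n) (λ k → sumM {suc (suc n)} (suc k) zero) = refl
diff∘sum {suc (suc n)} zero    (suc j) rewrite diffM-row₀ (suc n) (λ k → sumM {suc (suc n)} (suc k) (suc j)) = refl
diff∘sum {suc n}       (suc i) zero    = trans (ℤP.+-identityˡ _) (ΣFin-zero _ (λ k → ℤP.*-zeroʳ (diffM i k)))
diff∘sum {suc n}       (suc i) (suc j) = trans (ℤP.+-identityˡ _) (trans (diff∘sum i j) (sym (idM-suc i j)))

column-sum : ∀ {n} (j : Fin (suc n)) → ΣFin (λ k → diffM {suc n} k j) ≡ idM zero j
column-sum {n}     zero          = cong (λ z → + 1 ℤ.+ z) (ΣFin-zero {n} _ (λ k → refl))
column-sum {suc n} (suc zero)    rewrite column-sum {n} zero = refl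
column-sum {suc n} (suc (suc j)) rewrite column-sum {n} (suc j) = refl

sum∘diff : ∀ {n} (i j : Fin n) → (sumM ·ᴹ diffM) i j ≡ idM i j
sum∘diff {suc n} zero    j       = trans (ΣFin-cong (λ k → ℤP.*-identityˡ (diffM k j))) (column-sum j)
sum∘diff {suc n} (suc i) zero    = trans (ℤP.+-identityˡ _) (ΣFin-zero _ (λ k → ℤP.*-zeroʳ (sumM i k)))
sum∘diff {suc n} (suc i) (suc j) = trans (ℤP.+-identityˡ _) (trans (sum∘diff i j) (sym (idM-suc i j)))

diffM-GL : ∀ {n} → IsGLℤ (diffM {n})
diffM-GL = sumM , diff∘sum , sum∘diff

prefix : ∀ {n} → ℕ → Fin n → ℤ
prefix j i = if toℕ i ℕ.<ᵇ j then + 1 else + 0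

diff-prefix₀ : ∀ {n} (i : Fin n) → (diffM ·ᵛ prefix 0) i ≡ + 0
diff-prefix₀ i = ΣFin-zero _ (λ k → ℤP.*-zeroʳ (diffM i k))

diff-prefix : ∀ {n} j (j<n : j < n) (i : Fin n) → (diffM ·ᵛ prefix (suc j)) i ≡ unitVec (fromℕ< j<n) i
diff-prefix {suc zero}    zero    j<n       zero = refl
diff-prefix {suc (suc n)} zero    j<n       zero
  rewrite diffM-row₀ (suc n) (λ k → prefix {suc (suc n)} 1 (suc k)) = refl
diff-prefix {suc (suc n)} (suc j) j<n       zero
  rewrite diffM-row₀ (suc n) (λ k → prefix {suc (suc n)} (suc (suc j)) (suc k)) = refl
diff-prefix {suc n}       zero    j<n       (suc i) = trans (ℤP.+-identityˡ _) (diff-prefix₀ i)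
diff-prefix {suc n}       (suc j) (s≤s j<n) (suc i) =
  trans (ℤP.+-identityˡ _) (trans (diff-prefix j j<n i) (sym (idM-suc _ i)))

prefix-std : ∀ {n} m → m ≤ n → IsStdVertex (diffM {n} ·ᵛ prefix m)
prefix-std zero    _   = inj₁ diff-prefix₀
prefix-std (suc j) j<n = inj₂ (fromℕ< j<n , diff-prefix j j<n)

<ᵇ-true : ∀ {m n} → m < n → (m ℕ.<ᵇ n) ≡ true
<ᵇ-true m<n = Equivalence.to BoolP.T-≡ (ℕP.<⇒<ᵇ m<n)

<ᵇ-false : ∀ {m n} → n ≤ m → (m ℕ.<ᵇ n) ≡ false
<ᵇ-false {m}     {zero}  _         = refl
<ᵇ-false {suc m} {suc n} (s≤s n≤m) = <ᵇ-false n≤m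

Pairwise : ∀ {n} → List (Subset n) → Set
Pairwise L = ∀ {A B} → A ∈ₗ L → B ∈ₗ L → Comparable A B

AllPairs⇒Pairwise : ∀ {n} (L : List (Subset n)) → AllPairs Comparable L → Pairwise L
AllPairs⇒Pairwise (A ∷ As) (A~ ∷ _)  (here refl) (here refl) = inj₁ (λ x∈A → x∈A)
AllPairs⇒Pairwise (A ∷ As) (A~ ∷ _)  (here refl) (there B∈) = All.lookup A~ B∈
AllPairs⇒Pairwise (A ∷ As) (A~ ∷ _)  (there A∈) (here refl) with All.lookup A~ A∈
... | inj₁ B⊆A = inj₂ B⊆A
... | inj₂ A⊆B = inj₁ A⊆B
AllPairs⇒Pairwise (A ∷ As) (_ ∷ As~) (there A∈) (there B∈) = AllPairs⇒Pairwise As As~ A∈ B∈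

-- A is an initial segment for the order π: its elements are π(0), …, π(|A|-1).
Prefix : ∀ {n} → Permutation n n → Subset n → Set
Prefix π A = ∀ i → lookup A (π ⟨$⟩ʳ i) ≡ (toℕ i ℕ.<ᵇ ∣ A ∣)

-- Inserting 0 into a chain: the sets without 0 have size (of their tail)
-- at most the pivot, the sets containing 0 at least the pivot.
sizeWithout0 : ∀ {n} → Subset (suc n) → ℕ
sizeWithout0 (inside  ∷ t) = 0
sizeWithout0 (outside ∷ t) = ∣ t ∣

pivot : ∀ {n} → List (Subset (suc n)) → ℕ
pivot []       = 0
pivot (A ∷ As) = sizeWithout0 A ℕ.⊔ pivot As

pivot-ub : ∀ {n} (L : List (Subset (suc n))) {A} → A ∈ₗ L → sizeWithout0 A ≤ pivot L
pivot-ub (A ∷ As) (here refl) = ℕP.m≤m⊔n (sizeWithout0 A) (pivot As)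
pivot-ub (A ∷ As) (there A∈)  = ℕP.≤-trans (pivot-ub As A∈) (ℕP.m≤n⊔m (sizeWithout0 A) (pivot As))

pivot-lub : ∀ {n} (L : List (Subset (suc n))) c → (∀ {A} → A ∈ₗ L → sizeWithout0 A ≤ c) → pivot L ≤ c
pivot-lub []       c bound = z≤n
pivot-lub (A ∷ As) c bound = ℕP.⊔-lub (bound (here refl)) (pivot-lub As c (bound ∘ there))

pivot≤n : ∀ {n} (L : List (Subset (suc n))) → pivot L ≤ n
pivot≤n {n} L = pivot-lub L n size≤n
  where
  size≤n : ∀ {A} → A ∈ₗ L → sizeWithout0 A ≤ n
  size≤n {inside  ∷ t} _ = z≤n
  size≤n {outside ∷ t} _ = ∣p∣≤n t

pivot-≤ : ∀ {n} (L : List (Subset (suc n))) → Pairwise L → ∀ {t} → (inside ∷ t) ∈ₗ L → pivot L ≤ ∣ t ∣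
pivot-≤ L pw {t} t∈ = pivot-lub L ∣ t ∣ below
  where
  below : ∀ {A} → A ∈ₗ L → sizeWithout0 A ≤ ∣ t ∣
  below {inside  ∷ u} _  = z≤n
  below {outside ∷ u} u∈ with pw u∈ t∈
  ... | inj₁ u⊆t = p⊆q⇒∣p∣≤∣q∣ (drop-∷-⊆ u⊆t)
  ... | inj₂ t⊆u with t⊆u here
  ... | ()

tail : ∀ {n} → Subset (suc n) → Subset n
tail (a ∷ A) = A

tails-pairwise : ∀ {n} (L : List (Subset (suc n))) → Pairwise L → Pairwise (map tail L)
tails-pairwise L pw A∈ B∈ with MemP.∈-map⁻ tail A∈ | MemP.∈-map⁻ tail B∈
... | (a ∷ A) , aA∈ , refl | (b ∷ B) , bB∈ , refl with pw aA∈ bB∈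
... | inj₁ aA⊆bB = inj₁ (drop-∷-⊆ aA⊆bB)
... | inj₂ bB⊆aA = inj₂ (drop-∷-⊆ bB⊆aA)

insert-at : ∀ {m n} (i : Fin (suc m)) (j : Fin (suc n)) (π : Permutation m n) → insert i j π ⟨$⟩ʳ i ≡ j
insert-at i j π with i Fin.≟ i
... | yes _  = refl
... | no i≢i = contradiction refl i≢i

punchIn-view : ∀ {n} (p i : Fin (suc n)) → (i ≡ p) ⊎ (Σ (Fin n) λ k → i ≡ punchIn p k)
punchIn-view p i with p Fin.≟ i
... | yes p≡i = inj₁ (sym p≡i)
... | no  p≢i = inj₂ (punchOut p≢i , sym (FinP.punchIn-punchOut p≢i))

toℕ-punchIn-< : ∀ {n} (p : Fin (suc n)) (k : Fin n) → toℕ k < toℕ p → toℕ (punchIn p k) ≡ toℕ k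
toℕ-punchIn-< (suc p) zero    _         = refl
toℕ-punchIn-< (suc p) (suc k) (s≤s k<p) = cong suc (toℕ-punchIn-< p k k<p)

toℕ-punchIn-≥ : ∀ {n} (p : Fin (suc n)) (k : Fin n) → toℕ p ≤ toℕ k → toℕ (punchIn p k) ≡ suc (toℕ k)
toℕ-punchIn-≥ zero    k       _         = refl
toℕ-punchIn-≥ (suc p) (suc k) (s≤s p≤k) = cong suc (toℕ-punchIn-≥ p k p≤k)

-- Where the new coordinate 0 may be inserted into the order of the
-- remaining coordinates, for the set b ∷ t to stay an initial segment.
Fits : ∀ {n} → Fin (suc n) → Bool → Subset n → Set
Fits p inside  t = toℕ p ≤ ∣ t ∣
Fits p outside t = ∣ t ∣ ≤ toℕ p

insert-prefix : ∀ {n} (p : Fin (suc n)) (π : Permutation n n) b t →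
  Prefix π t → Fits p b t → Prefix (insert p zero π) (b ∷ t)
insert-prefix p π b t t-prefix fits i with punchIn-view p i
... | inj₁ refl rewrite insert-at p zero π = at-p b fits
  where
  at-p : ∀ b → Fits p b t → b ≡ (toℕ p ℕ.<ᵇ ∣ b ∷ t ∣)
  at-p inside  p≤t = sym (<ᵇ-true (s≤s p≤t))
  at-p outside t≤p = sym (<ᵇ-false t≤p)
... | inj₂ (k , refl) rewrite insert-punchIn p zero π k | t-prefix k = elsewhere b fits
  where
  elsewhere : ∀ b → Fits p b t → (toℕ k ℕ.<ᵇ ∣ t ∣) ≡ (toℕ (punchIn p k) ℕ.<ᵇ ∣ b ∷ t ∣)
  elsewhere b fits with toℕ k ℕ.<? toℕ p
  elsewhere outside t≤p | yes k<p rewrite toℕ-punchIn-< p k k<p = refl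
  elsewhere inside  p≤t | yes k<p rewrite toℕ-punchIn-< p k k<p
    | <ᵇ-true {toℕ k} {∣ t ∣} (ℕP.<-≤-trans k<p p≤t)
    | <ᵇ-true {toℕ k} {suc ∣ t ∣} (ℕP.m<n⇒m<1+n (ℕP.<-≤-trans k<p p≤t)) = refl
  elsewhere outside t≤p | no  k≮p rewrite toℕ-punchIn-≥ p k (ℕP.≮⇒≥ k≮p)
    | <ᵇ-false {toℕ k} {∣ t ∣} (ℕP.≤-trans t≤p (ℕP.≮⇒≥ k≮p))
    | <ᵇ-false {suc (toℕ k)} {∣ t ∣} (ℕP.m≤n⇒m≤1+n (ℕP.≤-trans t≤p (ℕP.≮⇒≥ k≮p))) = refl
  elsewhere inside  p≤t | no  k≮p rewrite toℕ-punchIn-≥ p k (ℕP.≮⇒≥ k≮p) = refl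

chain-prefixes : ∀ n (L : List (Subset n)) → Pairwise L →
  Σ (Permutation n n) λ π → ∀ {A} → A ∈ₗ L → Prefix π A
chain-prefixes zero    L pw = Perm.id , λ _ ()
chain-prefixes (suc n) L pw with chain-prefixes n (map tail L) (tails-pairwise L pw)
... | π , tails-initial = insert p zero π , initial
  where
  p : Fin (suc n)
  p = fromℕ< (s≤s (pivot≤n L))
  toℕp : toℕ p ≡ pivot L
  toℕp = FinP.toℕ-fromℕ< (s≤s (pivot≤n L))
  fits : ∀ b {t} → (b ∷ t) ∈ₗ L → Fits p b t
  fits inside  {t} bt∈ = subst (_≤ ∣ t ∣) (sym toℕp) (pivot-≤ L pw bt∈)
  fits outside {t} bt∈ = subst (∣ t ∣ ≤_) (sym toℕp) (pivot-ub L bt∈)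
  initial : ∀ {A} → A ∈ₗ L → Prefix (insert p zero π) A
  initial {b ∷ t} bt∈ = insert-prefix p π b t (tails-initial (MemP.∈-map⁺ tail bt∈)) (fits b bt∈)

IsStdVertex-resp : ∀ {n} {x y : Fin n → ℤ} → (∀ i → x i ≡ y i) → IsStdVertex y → IsStdVertex x
IsStdVertex-resp x≡y (inj₁ y≡0)        = inj₁ (λ i → trans (x≡y i) (y≡0 i))
IsStdVertex-resp x≡y (inj₂ (j , y≡eⱼ)) = inj₂ (j , λ i → trans (x≡y i) (y≡eⱼ i))

-- Every simplex of C^n is unimodular: after permuting coordinates so that
-- the chain consists of initial segments, Δ maps its vertices to 0 and
-- standard unit vectors.
chain-unimodular : ∀ {n} (L : List (Subset n)) → AllPairs Comparable L → UnimodularSimplex L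
chain-unimodular {n} L comparable with chain-prefixes n L (AllPairs⇒Pairwise L comparable)
... | π , initial = diffM ·ᴹ permM π , GL-* diffM (permM π) diffM-GL (permM-GL π) , All.tabulate standard
  where
  standard : ∀ {A} → A ∈ₗ L → IsStdVertex ((diffM ·ᴹ permM π) ·ᵛ indicator A)
  standard {A} A∈ = IsStdVertex-resp
    (λ i → trans (mv-assoc diffM (permM π) (indicator A) i)
                 (mv-cong diffM (λ k → trans (permM-mv π (indicator A) k)
                   (cong (λ b → if b then + 1 else + 0) (initial A∈ k))) i))
    (prefix-std ∣ A ∣ (∣p∣≤n A))

nonempty : ∀ {n} (F : Subset n) → 1 ≤ ∣ F ∣ → Nonempty F
nonempty (inside  ∷ F) _   = zero , here
nonempty (outside ∷ F) 1≤∣F∣ with nonempty F 1≤∣F∣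
... | v , v∈F = suc v , there v∈F

-- Every simplex of P_F is a simplex of C^n, hence unimodular.
P-unimodular : ∀ {n} (F : Subset n) → UnimodularP F
P-unimodular F []       (() , _)
P-unimodular F (A ∷ As) ((_ , comparable) , _) = chain-unimodular (A ∷ As) comparable

proposition4p1 : (n k : ℕ) (F : Subset n) → ∣ F ∣ ≡ k → 1 ≤ k →
    UnimodularP F × IsoToBraid F (suc (n ∸ k)) ×
    (∀ i → i ≤ suc (n ∸ k) →
      + fP F i ≡ Σ≤ i (λ j → sgn j ℤ.* + (i C j) ℤ.* + ((2 ℕ.+ (i ∸ j)) ℕ.^ suc (n ∸ k)))) ×
    (∀ n' i → suc (n ∸ k) ≤ n' → i ≤ suc n' →
      hP F n' i ≡ sgn i ℤ.* + (suc n' C i) ℤ.+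
        Σ< i (λ a → Σ≤ a (λ b →
          sgn ((i ∸ a) ℕ.+ b ∸ 1) ℤ.* + ((n' ∸ a) C (i ∸ a ∸ 1)) ℤ.* + (a C b)
            ℤ.* + ((2 ℕ.+ (a ∸ b)) ℕ.^ suc (n ∸ k)))))
proposition4p1 n .(∣ F ∣) F refl 1≤∣F∣ rewrite sym (∣∁p∣≡n∸∣p∣ F) =
  P-unimodular F , iso , (λ i _ → f-formula i) , (λ n' i _ _ → hFromF F (suc ∣ ∁ F ∣) f-formula n' i)
  where
  open VertexMap F (proj₁ (nonempty F 1≤∣F∣)) (proj₂ (nonempty F 1≤∣F∣))
  f-formula : ∀ i → + fP F i ≡ braidF (suc ∣ ∁ F ∣) i
  f-formula i = trans (fP-invariant i) (trans (braid-fP (suc ∣ ∁ F ∣) i) (braidFormula (suc ∣ ∁ F ∣) i))
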